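{- Let $G_1,G_2$ be 2-connected simple graphs each satisfying $(\spadesuit)_2$, and let $e_1\in E(G_1)$, $e_2\in E(G_2)$. Let $G$ be the collision of $G_1,G_2$ on $e_1,e_2$, i.e. the graph obtained by gluing $G_1$ and $G_2$ along $e_1$ and $e_2$ (identifying these edges and their endpoints) and then removing the identified edge. Then $G$ satisfies $(\spadesuit)_2$.
   Context: A graph is 2-connected if connected, with at least two vertices and no cut vertex (a single edge counts as 2-connected). A 2-connected simple graph $H=(V,E)$ satisfies $(\spadesuit)_2$ if $|E|=2(|V|-1)$ and $|E(S)|=2|S|-3$ for every good flat $S\subset V$, where $E(S)$ is the set of edges with both ends in $S$ and $S$ is a good flat if $H|_S$ is 2-connected and the graph obtained from $H$ by contracting all edges of $E(S)$ is 2-connected. -}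

module Defs where

open import Data.Nat using (ℕ; zero; suc; _+_; _*_; _∸_; _<ᵇ_)
open import Data.Bool using (Bool; true; false; _∧_; _∨_; not; if_then_else_)
open import Data.Fin using (Fin; zero; suc; toℕ; splitAt; punchIn; punchOut; _≟_)
open import Data.Fin.Subset using (Subset; _∈_; _∉_; ∣_∣)
open import Data.Vec using (lookup)
open import Data.List using (List; map; allFin)
open import Data.Nat.ListAction using (sum)
open import Data.Maybe using (Maybe; just; nothing)
open import Data.Sum using (_⊎_; inj₁; inj₂)
open import Data.Product using (Σ; _×_; _,_; ∃)
open import Data.Unit using (⊤; tt)
open import Data.Empty using (⊥)
open import Relation.Nullary using (¬_; yes; no)
open import Relation.Nullary.Decidable using (⌊_⌋)
open import Relation.Binary.PropositionalEquality using (_≡_; _≢_)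

Graph : ℕ → Set
Graph n = Fin n → Fin n → Bool

IsSimple : ∀ {n} → Graph n → Set
IsSimple {n} H = (∀ (i j : Fin n) → H i j ≡ H j i) × (∀ (i : Fin n) → H i i ≡ false)

-- A walk in P uses only vertices satisfying P (and edges between them),
-- i.e. it is a walk in the induced subgraph on P.

data Walk {V : Set} (E : V → V → Set) (P : V → Set) : V → V → Set where
  here : ∀ {v} → Walk E P v v
  step : ∀ {u v w} → P v → E u v → Walk E P v w → Walk E P u w

Connected : {V : Set} → (V → V → Set) → (V → Set) → Set
Connected {V} E P = ∀ (u v : V) → P u → P v → Walk E P u v

TwoConnected : {V : Set} → (V → V → Set) → (V → Set) → Set
TwoConnected {V} E P =
  (Σ V λ u → Σ V λ v → P u × P v × u ≢ v)
  × Connected E P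
  × (∀ (w : V) → P w → Connected E (λ x → P x × x ≢ w))

Edge : ∀ {n} → Graph n → Fin n → Fin n → Set
Edge H i j = H i j ≡ true

AllV : ∀ {n} → Fin n → Set
AllV _ = ⊤

TwoConnectedGraph : ∀ {n} → Graph n → Set
TwoConnectedGraph H = TwoConnected (Edge H) AllV

InducedTwoConnected : ∀ {n} → Graph n → Subset n → Set
InducedTwoConnected H S = TwoConnected (Edge H) (λ i → i ∈ S)

-- The graph H / E(S) obtained by contracting all edges with both ends in S.
-- Vertices: `nothing` is the vertex into which S is contracted (S is
-- connected whenever H|_S is 2-connected, so it becomes a single vertex),
-- `just v` for v ∉ S.  Loops created by contraction are irrelevant to
-- connectivity and are omitted; parallel edges are irrelevant as well.
ContrEdge : ∀ {n} → Graph n → Subset n → Maybe (Fin n) → Maybe (Fin n) → Set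
ContrEdge H S (just u) (just v) = H u v ≡ true
ContrEdge H S nothing  (just v) = Σ _ λ s → s ∈ S × H s v ≡ true
ContrEdge H S (just u) nothing  = Σ _ λ s → s ∈ S × H u s ≡ true
ContrEdge H S nothing  nothing  = ⊥

ContrVert : ∀ {n} → Subset n → Maybe (Fin n) → Set
ContrVert S nothing  = ⊤
ContrVert S (just v) = v ∉ S

ContractedTwoConnected : ∀ {n} → Graph n → Subset n → Set
ContractedTwoConnected H S = TwoConnected (ContrEdge H S) (ContrVert S)

GoodFlat : ∀ {n} → Graph n → Subset n → Set
GoodFlat H S = InducedTwoConnected H S × ContractedTwoConnected H S

count01 : Bool → ℕ
count01 true  = 1
count01 false = 0

edgesIn : ∀ {n} → Graph n → Subset n → ℕ
edgesIn {n} H S =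
  sum (map (λ i → sum (map (λ j →
    count01 ((toℕ i <ᵇ toℕ j) ∧ lookup S i ∧ lookup S j ∧ H i j))
    (allFin n))) (allFin n))

numEdges : ∀ {n} → Graph n → ℕ
numEdges {n} H =
  sum (map (λ i → sum (map (λ j → count01 ((toℕ i <ᵇ toℕ j) ∧ H i j))
    (allFin n))) (allFin n))

-- H is a 2-connected simple graph satisfying (♠)₂
-- (|V| = n, so |E| = 2(|V|-1); for a good flat |S| ≥ 2, so ∸ is exact).
Spade2 : ∀ {n} → Graph n → Set
Spade2 {n} H =
  IsSimple H × TwoConnectedGraph H
  × numEdges H ≡ 2 * (n ∸ 1)
  × (∀ (S : Subset n) → GoodFlat H S → edgesIn H S ≡ 2 * ∣ S ∣ ∸ 3)

-- Collision of G₁ (on Fin n₁) and G₂ (on Fin n₂) on the edges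
-- e₁ = (a₁,b₁), e₂ = (a₂,b₂): glue a₂ onto a₁ and b₂ onto b₁, then delete
-- the identified edge.  Vertex set Fin (n₁ + (n₂ ∸ 2)): the first n₁
-- vertices are those of G₁; the remaining n₂ ∸ 2 are the vertices of G₂
-- other than a₂, b₂, enumerated in increasing order by `emb`.

_==_ : ∀ {n} → Fin n → Fin n → Bool
i == j = ⌊ i ≟ j ⌋

-- position of b among Fin (suc (suc m)) ∖ {a} (arbitrary if a = b)
skipOut : ∀ {m} → Fin (suc (suc m)) → Fin (suc (suc m)) → Fin (suc m)
skipOut a b with a ≟ b
... | yes _ = zero
... | no p  = punchOut p

-- j-th vertex of Fin (suc (suc m)) ∖ {a, b}
emb : ∀ {m} → Fin (suc (suc m)) → Fin (suc (suc m)) → Fin m → Fin (suc (suc m))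
emb a b j = punchIn a (punchIn (skipOut a b) j)

collision : ∀ {n₁ n₂} → Graph n₁ → Graph n₂ → Fin n₁ → Fin n₁ → Fin n₂ → Fin n₂
          → Graph (n₁ + (n₂ ∸ 2))
collision {n₁} {suc zero} G₁ G₂ a₁ b₁ a₂ b₂ u v = false   -- impossible case (no edge in G₂)
collision {n₁} {suc (suc m)} G₁ G₂ a₁ b₁ a₂ b₂ u v = adj (splitAt n₁ u) (splitAt n₁ v)
  where
  glue : Fin n₁ → Maybe (Fin (suc (suc m)))
  glue i = if i == a₁ then just a₂ else (if i == b₁ then just b₂ else nothing)

  cross : Fin n₁ → Fin m → Bool
  cross i j with glue i
  ... | just w  = G₂ w (emb a₂ b₂ j)
  ... | nothing = false

  isE₁ : Fin n₁ → Fin n₁ → Bool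
  isE₁ i k = ((i == a₁) ∧ (k == b₁)) ∨ ((i == b₁) ∧ (k == a₁))

  adj : Fin n₁ ⊎ Fin m → Fin n₁ ⊎ Fin m → Bool
  adj (inj₁ i) (inj₁ k) = G₁ i k ∧ not (isE₁ i k)
  adj (inj₁ i) (inj₂ l) = cross i l
  adj (inj₂ j) (inj₁ k) = cross k j
  adj (inj₂ j) (inj₂ l) = G₂ (emb a₂ b₂ j) (emb a₂ b₂ l)

{-# OPTIONS --safe #-}
-- Write G for the collision and a, b for the glued ends; {a, b} separates the two sides of G.
-- Counting vertices and edges side by side gives |V| = |V₁| + |V₂| - 2 and |E| = |E₁| + |E₂| - 2,
-- hence |E| = 2(|V| - 1).  G is 2-connected: a walk can always be routed to a or b inside one
-- side, and G - v still joins a to b through a side not containing v (Gᵢ - aᵢbᵢ joins aᵢ to bᵢ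
-- through a third vertex).  A good flat S of G either meets only one side beyond {a, b} without
-- containing both, or contains one whole side; projecting G onto a side (collapsing the other
-- side onto a or b) is a retraction, so S restricts to a good flat of G₁ or G₂, and the
-- count |E(S)| = 2|S| - 3 is inherited from that flat, using |E(Gᵢ)| = 2(|V(Gᵢ)| - 1) when S
-- contains a whole side.
module Submission where

open import Defs
open import Data.Bool using (Bool; true; false; _∧_; _∨_; not; T)
open import Data.Bool.Properties using (∧-zeroʳ; ∧-identityʳ; ∧-comm; ∧-assoc; ∨-comm)
open import Data.Empty using (⊥; ⊥-elim)
open import Data.Fin using (Fin; zero; suc; toℕ; splitAt; punchIn; punchOut; _↑ˡ_; _↑ʳ_; _≟_)
open import Data.Fin.Properties
  using (splitAt-↑ˡ; splitAt-↑ʳ; splitAt⁻¹-↑ˡ; splitAt⁻¹-↑ʳ; punchIn-punchOut; punchInᵢ≢i; punchIn-injective;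
         ↑ˡ-injective; ↑ʳ-injective; toℕ-injective)
open import Data.Fin.Subset using (Subset; _∈_; ∣_∣)
open import Data.Fin.Subset.Properties using (_∈?_)
import Data.List as List
open import Data.Maybe using (Maybe; just; nothing; _>>=_)
import Data.Maybe as Maybe
open import Data.Maybe.Properties using (just-injective; ≡-dec)
open import Data.Nat using (ℕ; zero; suc; _+_; _*_; _∸_; _<ᵇ_)
open import Data.Nat.ListAction using () renaming (sum to listSum)
open import Data.Nat.Properties
  using (+-suc; +-comm; +-assoc; +-identityʳ; +-cancelʳ-≡; *-cancelˡ-≡; *-distribˡ-+; +-0-commutativeMonoid;
         <ᵇ⇒<; <⇒<ᵇ; <-asym; <-cmp)
open import Algebra.Properties.CommutativeMonoid.Sum +-0-commutativeMonoid
  using (sum; ∑-distrib-+; ∑-comm; sum-remove; sum-cong-≗; sum-replicate-zero)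
open import Data.Nat.Tactic.RingSolver using (solve-∀)
open import Data.Product using (Σ; _×_; _,_; proj₁; proj₂)
import Data.Product as Prod
open import Data.Sum using (_⊎_; inj₁; inj₂)
import Data.Sum as Sum
open import Data.Unit using (⊤; tt)
open import Data.Vec using ([]; _∷_; lookup; tabulate)
open import Data.Vec.Properties using ([]=⇒lookup; lookup⇒[]=; lookup∘tabulate)
open import Function.Bundles using (_⇔_; mk⇔; Equivalence)
open import Relation.Binary using (tri<; tri≈; tri>)
open import Relation.Binary.PropositionalEquality
open ≡-Reasoning
open import Relation.Nullary using (¬_; yes; no; Dec)

-- Walks and retractions

module _ {V : Set} {E : V → V → Set} where

  _++ʷ_ : ∀ {P u v w} → Walk E P u v → Walk E P v w → Walk E P u w
  here ++ʷ q = q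
  step p e r ++ʷ q = step p e (r ++ʷ q)

  snocʷ : ∀ {P u v w} → Walk E P u v → P w → E v w → Walk E P u w
  snocʷ here pw e = step pw e here
  snocʷ (step p e r) pw e' = step p e (snocʷ r pw e')

  reverseʷ : ∀ {P u v} → (∀ {x y} → E x y → E y x) → P u → Walk E P u v → Walk E P v u
  reverseʷ sym pu here = here
  reverseʷ sym pu (step pv e r) = snocʷ (reverseʷ sym pv r) pu (sym e)

  Walk-end : ∀ {P u v} → P u → Walk E P u v → P v
  Walk-end pu here = pu
  Walk-end pu (step pv e r) = Walk-end pv r

  Walk-mono : ∀ {P Q : V → Set} {u v} → (∀ {x} → P x → Q x) → Walk E P u v → Walk E Q u v
  Walk-mono f here = here
  Walk-mono f (step p e r) = step (f p) e (Walk-mono f r)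

  -- h is the first vertex of the walk in T and y its predecessor.
  firstEntry : ∀ {P : V → Set} (T : V → Set) (T? : ∀ x → Dec (T x)) {u v} →
               Walk E P u v → T v → ¬ T u →
               Σ V λ y → Σ V λ h → Walk E (λ x → P x × ¬ T x) u y × E y h × T h × P h
  firstEntry T T? here tv ntu = ⊥-elim (ntu tv)
  firstEntry T T? {u} (step {v = w} pw e r) tv ntu with T? w
  ... | yes tw = u , w , here , e , tw , pw
  ... | no ntw with firstEntry T T? r tv ntw
  ... | y , h , r' , e' , th , ph = y , h , step (pw , ntw) e r' , e' , th , ph

  Connected-mono : ∀ {P Q : V → Set} → (∀ {x} → P x → Q x) → (∀ {x} → Q x → P x) →
                   Connected E P → Connected E Q
  Connected-mono f g c u v qu qv = Walk-mono f (c u v (g qu) (g qv))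

  Connected-viaHub : ∀ {P : V → Set} → (∀ {x y} → E x y → E y x) →
                     (h : V) → (∀ x → P x → Walk E P x h) → Connected E P
  Connected-viaHub sym h r u v pu pv = r u pu ++ʷ reverseʷ sym pv (r v pv)

EdgeMap : {V W : Set} → (V → V → Set) → (W → W → Set) → (V → W) → Set
EdgeMap {V} E E' f = ∀ {x y : V} → E x y → f x ≡ f y ⊎ E' (f x) (f y)

WeakHom : {V W : Set} → (V → V → Set) → (W → W → Set) → (V → Set) → (V → W) → Set
WeakHom {V} E E' P f = ∀ {x y : V} → P x → P y → E x y → f x ≡ f y ⊎ E' (f x) (f y)

module _ {V W : Set} {E : V → V → Set} {E' : W → W → Set} where

  mapʷ : ∀ {P P'} (f : V → W) → WeakHom E E' P f → (∀ {x} → P x → P' (f x)) →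
         ∀ {u v} → P u → Walk E P u v → Walk E' P' (f u) (f v)
  mapʷ f hom vp pu here = here
  mapʷ {P' = P'} f hom vp pu (step {v = w} {w = t} pw e r) with hom pu pw e
  ... | inj₁ eq = subst (λ z → Walk E' P' z (f t)) (sym eq) (mapʷ f hom vp pw r)
  ... | inj₂ e' = step (vp pw) e' (mapʷ f hom vp pw r)

  Connected-retract : ∀ {P P'} (f : V → W) (g : W → V) → WeakHom E E' P f →
                      (∀ {x} → P x → P' (f x)) → (∀ {w} → P' w → P (g w)) →
                      (∀ {w} → P' w → f (g w) ≡ w) →
                      Connected E P → Connected E' P'
  Connected-retract {P' = P'} f g hom vp gp fg c u v pu pv =
    subst₂ (Walk E' P') (fg pu) (fg pv) (mapʷ f hom vp (gp pu) (c (g u) (g v) (gp pu) (gp pv)))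

  -- The retraction may depend on the deleted vertex (nothing: no vertex deleted),
  -- as long as it never sends a surviving vertex onto the deleted one.
  TwoConnected-retract : ∀ {P P'}
    (f : Maybe W → V → W) (g : W → V) →
    (Σ W λ u → Σ W λ v → P' u × P' v × u ≢ v) →
    (∀ {k} → WeakHom E E' P (f k)) →
    (∀ {k x} → P x → P' (f k x)) → (∀ {w} → P' w → P (g w)) →
    (∀ {k w} → P' w → f k (g w) ≡ w) →
    (∀ {w x} → P' w → P x → x ≢ g w → f (just w) x ≢ w) →
    TwoConnected E P → TwoConnected E' P'
  TwoConnected-retract {P} {P'} f g pair hom vp gp fg avoid (_ , c , cut) =
    pair ,
    Connected-retract (f nothing) g hom vp gp fg c ,
    λ w pw → Connected-retract {P = λ x → P x × x ≢ g w} {P' = λ x → P' x × x ≢ w} (f (just w)) g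
      (λ px py e → hom (proj₁ px) (proj₁ py) e)
      (λ px → vp (proj₁ px) , avoid pw (proj₁ px) (proj₂ px))
      (λ pw' → gp (proj₁ pw') , λ eq → proj₂ pw' (trans (sym (fg (proj₁ pw'))) (trans (cong (f (just w)) eq) (fg pw))))
      (λ pw' → fg (proj₁ pw'))
      (cut (g w) (gp pw))

TwoConnected-resp : ∀ {V : Set} {E E' : V → V → Set} {P P' : V → Set} →
                    (∀ {x y} → E x y → E' x y) → (∀ {x} → P x → P' x) → (∀ {x} → P' x → P x) →
                    TwoConnected E P → TwoConnected E' P'
TwoConnected-resp ee pp pp' tc@((u , v , pu , pv , u≢v) , _) =
  TwoConnected-retract (λ _ x → x) (λ x → x) (u , v , pp pu , pp pv , u≢v)
    (λ _ _ e → inj₂ (ee e)) pp pp' (λ _ → refl) (λ _ _ ne → ne) tc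

-- Contraction

-- ContrEdge and ContrVert of Defs, for an arbitrary vertex type and vertex predicate.
Contract : ∀ {V : Set} → (V → V → Set) → (V → Set) → Maybe V → Maybe V → Set
Contract E P (just u) (just v) = E u v
Contract {V} E P nothing (just v) = Σ V λ s → P s × E s v
Contract {V} E P (just u) nothing = Σ V λ s → P s × E u s
Contract E P nothing nothing = ⊥

ContractVert : ∀ {V : Set} → (V → Set) → Maybe V → Set
ContractVert P nothing = ⊤
ContractVert P (just v) = ¬ P v

IsGoodFlat : ∀ {V : Set} → (V → V → Set) → (V → Set) → Set
IsGoodFlat E P = TwoConnected E P × TwoConnected (Contract E P) (ContractVert P)

module _ {n} (H : Graph n) (S : Subset n) where

  ContrEdge⇒Contract : ∀ {x y} → ContrEdge H S x y → Contract (Edge H) (_∈ S) x y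
  ContrEdge⇒Contract {just u} {just v} e = e
  ContrEdge⇒Contract {nothing} {just v} e = e
  ContrEdge⇒Contract {just u} {nothing} e = e

  ContrVert⇒ContractVert : ∀ {x} → ContrVert S x → ContractVert (_∈ S) x
  ContrVert⇒ContractVert {nothing} _ = tt
  ContrVert⇒ContractVert {just v} v∉S = v∉S

  ContractVert⇒ContrVert : ∀ {x} → ContractVert (_∈ S) x → ContrVert S x
  ContractVert⇒ContrVert {nothing} _ = tt
  ContractVert⇒ContrVert {just v} v∉S = v∉S

  GoodFlat⇒IsGoodFlat : GoodFlat H S → IsGoodFlat (Edge H) (_∈ S)
  GoodFlat⇒IsGoodFlat (tc , tc/S) =
    tc , TwoConnected-resp ContrEdge⇒Contract ContrVert⇒ContractVert ContractVert⇒ContrVert tc/S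

  IsGoodFlat⇒GoodFlat : ∀ {P} → (∀ {x} → P x ⇔ x ∈ S) → IsGoodFlat (Edge H) P → GoodFlat H S
  IsGoodFlat⇒GoodFlat {P} P⇔S (tc , tc/P) =
    TwoConnected-resp (λ e → e) to from tc , TwoConnected-resp edge vert vert⁻ tc/P
    where
    to : ∀ {x} → P x → x ∈ S
    to = Equivalence.to P⇔S
    from : ∀ {x} → x ∈ S → P x
    from = Equivalence.from P⇔S
    edge : ∀ {x y} → Contract (Edge H) P x y → ContrEdge H S x y
    edge {just u} {just v} e = e
    edge {nothing} {just v} (s , ps , e) = s , to ps , e
    edge {just u} {nothing} (s , ps , e) = s , to ps , e
    vert : ∀ {x} → ContractVert P x → ContrVert S x
    vert {nothing} _ = tt
    vert {just v} v∉P v∈S = v∉P (from v∈S)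
    vert⁻ : ∀ {x} → ContrVert S x → ContractVert P x
    vert⁻ {nothing} _ = tt
    vert⁻ {just v} v∉S v∈P = v∉S (to v∈P)

module Collapse {W : Set} {P' : W → Set} (P? : ∀ y → Dec (P' y)) where

  collapse : W → Maybe W
  collapse y with P? y
  ... | yes _ = nothing
  ... | no _ = just y

  collapse-cases : ∀ y → (P' y × collapse y ≡ nothing) ⊎ (¬ P' y × collapse y ≡ just y)
  collapse-cases y with P? y
  ... | yes p = inj₁ (p , refl)
  ... | no n = inj₂ (n , refl)

  collapse-vert : ∀ y → ContractVert P' (collapse y)
  collapse-vert y with P? y
  ... | yes _ = tt
  ... | no n = n

  collapse-in : ∀ {y} → P' y → collapse y ≡ nothing
  collapse-in {y} p with P? y
  ... | yes _ = refl
  ... | no n = ⊥-elim (n p)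

  collapse-out : ∀ {y} → ¬ P' y → collapse y ≡ just y
  collapse-out {y} n with P? y
  ... | yes p = ⊥-elim (n p)
  ... | no _ = refl

  collapse-edgeMap : ∀ {V : Set} {E : V → V → Set} {E' : W → W → Set} {P : V → Set} (π : V → W) →
                     EdgeMap E E' π → (∀ {s} → P s → P' (π s)) →
                     EdgeMap (Contract E P) (Contract E' P') (λ x → x >>= λ u → collapse (π u))
  collapse-edgeMap π hom πP {just u} {just v} e with hom e
  ... | inj₁ eq = inj₁ (cong collapse eq)
  ... | inj₂ e' with collapse-cases (π u) | collapse-cases (π v)
  ...   | inj₁ (_ , p) | inj₁ (_ , q) = inj₁ (trans p (sym q))
  ...   | inj₁ (pu , p) | inj₂ (_ , q) rewrite p | q = inj₂ (π u , pu , e')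
  ...   | inj₂ (_ , p) | inj₁ (pv , q) rewrite p | q = inj₂ (π v , pv , e')
  ...   | inj₂ (_ , p) | inj₂ (_ , q) rewrite p | q = inj₂ e'
  collapse-edgeMap π hom πP {nothing} {just v} (s , ps , e) with hom e
  ... | inj₁ eq = inj₁ (sym (collapse-in (subst P' eq (πP ps))))
  ... | inj₂ e' with collapse-cases (π v)
  ...   | inj₁ (_ , q) = inj₁ (sym q)
  ...   | inj₂ (_ , q) rewrite q = inj₂ (π s , πP ps , e')
  collapse-edgeMap π hom πP {just u} {nothing} (s , ps , e) with hom e
  ... | inj₁ eq = inj₁ (collapse-in (subst P' (sym eq) (πP ps)))
  ... | inj₂ e' with collapse-cases (π u)
  ...   | inj₁ (_ , q) = inj₁ q
  ...   | inj₂ (_ , q) rewrite q = inj₂ (π s , πP ps , e')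

unContractʷ : ∀ {V : Set} {E : V → V → Set} {P : V → Set} {z w : V} → ¬ P z →
              Walk (Contract E P) (λ x → ContractVert P x × x ≢ nothing) (just z) (just w) →
              Walk E (λ v → ¬ P v) z w
unContractʷ {V} {E} {P} {z} nz r = mapʷ (Maybe.fromMaybe z) edge vert (nz , λ ()) r
  where
  edge : WeakHom (Contract E P) E (λ x → ContractVert P x × x ≢ nothing) (Maybe.fromMaybe z)
  edge {just a} {just b} _ _ e = inj₂ e
  edge {nothing} (_ , n) _ _ = ⊥-elim (n refl)
  edge {just a} {nothing} _ (_ , n) _ = ⊥-elim (n refl)
  vert : ∀ {x} → ContractVert P x × x ≢ nothing → ¬ P (Maybe.fromMaybe z x)
  vert {just a} (n , _) = n
  vert {nothing} (_ , n) = ⊥-elim (n refl)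

-- Gluing two graphs along an edge

-- A graph (V, E) glued from (V₁, E₁) and (V₂, E₂) along a₁b₁ = a₂b₂, with that edge removed.
record Gluing : Set₁ where
  field
    V V₁ V₂ : Set
    E : V → V → Set
    E₁ : V₁ → V₁ → Set
    E₂ : V₂ → V₂ → Set
    a₁ b₁ : V₁
    a₂ b₂ : V₂
    ι₁ : V₁ → V
    ι₂ : V₂ → V
    _≟V_ : (x y : V) → Dec (x ≡ y)
    _≟₁_ : (x y : V₁) → Dec (x ≡ y)
    _≟₂_ : (x y : V₂) → Dec (x ≡ y)
    ι₁-injective : ∀ {x y} → ι₁ x ≡ ι₁ y → x ≡ y
    ι₂-injective : ∀ {x y} → ι₂ x ≡ ι₂ y → x ≡ y
    ι-a : ι₁ a₁ ≡ ι₂ a₂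
    ι-b : ι₁ b₁ ≡ ι₂ b₂
    ι-meet : ∀ {x y} → ι₁ x ≡ ι₂ y → (x ≡ a₁ × y ≡ a₂) ⊎ (x ≡ b₁ × y ≡ b₂)
    ι-cover : ∀ v → (Σ V₁ λ x → ι₁ x ≡ v) ⊎ (Σ V₂ λ y → ι₂ y ≡ v)
    E-sym : ∀ {x y} → E x y → E y x
    E₁-sym : ∀ {x y} → E₁ x y → E₁ y x
    E₂-sym : ∀ {x y} → E₂ x y → E₂ y x
    E-reflect : ∀ {u v} → E u v →
                (Σ V₁ λ x → Σ V₁ λ y → ι₁ x ≡ u × ι₁ y ≡ v × E₁ x y)
              ⊎ (Σ V₂ λ x → Σ V₂ λ y → ι₂ x ≡ u × ι₂ y ≡ v × E₂ x y)
    E₁-embed : ∀ {x y} → E₁ x y → ¬ (x ≡ a₁ × y ≡ b₁) → ¬ (x ≡ b₁ × y ≡ a₁) → E (ι₁ x) (ι₁ y)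
    E₂-embed : ∀ {x y} → E₂ x y → ¬ (x ≡ a₂ × y ≡ b₂) → ¬ (x ≡ b₂ × y ≡ a₂) → E (ι₂ x) (ι₂ y)
    a₁b₁ : E₁ a₁ b₁
    a₂b₂ : E₂ a₂ b₂
    a₁≢b₁ : a₁ ≢ b₁
    a₂≢b₂ : a₂ ≢ b₂
    c₁ : V₁
    c₁≢a₁ : c₁ ≢ a₁
    c₁≢b₁ : c₁ ≢ b₁
    c₂ : V₂
    c₂≢a₂ : c₂ ≢ a₂
    c₂≢b₂ : c₂ ≢ b₂

swap : Gluing → Gluing
swap g = record
  { V = V ; V₁ = V₂ ; V₂ = V₁ ; E = E ; E₁ = E₂ ; E₂ = E₁
  ; a₁ = a₂ ; b₁ = b₂ ; a₂ = a₁ ; b₂ = b₁ ; ι₁ = ι₂ ; ι₂ = ι₁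
  ; _≟V_ = _≟V_ ; _≟₁_ = _≟₂_ ; _≟₂_ = _≟₁_
  ; ι₁-injective = ι₂-injective ; ι₂-injective = ι₁-injective
  ; ι-a = sym ι-a ; ι-b = sym ι-b
  ; ι-meet = λ eq → meet-swap (ι-meet (sym eq))
  ; ι-cover = λ v → Sum.swap (ι-cover v)
  ; E-sym = E-sym ; E₁-sym = E₂-sym ; E₂-sym = E₁-sym
  ; E-reflect = λ e → Sum.swap (E-reflect e)
  ; E₁-embed = E₂-embed ; E₂-embed = E₁-embed ; a₁b₁ = a₂b₂ ; a₂b₂ = a₁b₁ ; a₁≢b₁ = a₂≢b₂ ; a₂≢b₂ = a₁≢b₁
  ; c₁ = c₂ ; c₁≢a₁ = c₂≢a₂ ; c₁≢b₁ = c₂≢b₂ ; c₂ = c₁ ; c₂≢a₂ = c₁≢a₁ ; c₂≢b₂ = c₁≢b₁ }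
  where
  open Gluing g
  meet-swap : ∀ {x y} → (x ≡ a₁ × y ≡ a₂) ⊎ (x ≡ b₁ × y ≡ b₂) → (y ≡ a₂ × x ≡ a₁) ⊎ (y ≡ b₂ × x ≡ b₁)
  meet-swap = Sum.map Prod.swap Prod.swap

module Sides (g : Gluing) where
  open Gluing g

  A B : V
  A = ι₁ a₁
  B = ι₁ b₁

  data Position (v : V) : Set where
    inner₁ : (x : V₁) → x ≢ a₁ → x ≢ b₁ → ι₁ x ≡ v → Position v
    inner₂ : (y : V₂) → y ≢ a₂ → y ≢ b₂ → ι₂ y ≡ v → Position v
    atA : A ≡ v → Position v
    atB : B ≡ v → Position v

  position : ∀ v → Position v
  position v with ι-cover v
  ... | inj₁ (x , eq) with x ≟₁ a₁
  ...   | yes refl = atA eq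
  ...   | no xa with x ≟₁ b₁
  ...     | yes refl = atB eq
  ...     | no xb = inner₁ x xa xb eq
  position v | inj₂ (y , eq) with y ≟₂ a₂
  ...   | yes refl = atA (trans ι-a eq)
  ...   | no ya with y ≟₂ b₂
  ...     | yes refl = atB (trans ι-b eq)
  ...     | no yb = inner₂ y ya yb eq

  ι₁≢ι₂ˡ : ∀ {x y} → x ≢ a₁ → x ≢ b₁ → ι₁ x ≢ ι₂ y
  ι₁≢ι₂ˡ xa xb eq with ι-meet eq
  ... | inj₁ (p , _) = xa p
  ... | inj₂ (p , _) = xb p

  ι₁≢ι₂ʳ : ∀ {x y} → y ≢ a₂ → y ≢ b₂ → ι₁ x ≢ ι₂ y
  ι₁≢ι₂ʳ ya yb eq with ι-meet eq
  ... | inj₁ (_ , p) = ya p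
  ... | inj₂ (_ , p) = yb p

  no-inner-edge : ∀ {x y} → x ≢ a₁ → x ≢ b₁ → y ≢ a₂ → y ≢ b₂ → ¬ E (ι₁ x) (ι₂ y)
  no-inner-edge xa xb ya yb e with E-reflect e
  ... | inj₁ (_ , _ , _ , q , _) = ι₁≢ι₂ʳ ya yb q
  ... | inj₂ (_ , _ , p , _ , _) = ι₁≢ι₂ˡ xa xb (sym p)

  walk-meets-A-or-B : ∀ {P : V → Set} {u v} → Walk E P u v →
                      (x : V₁) → x ≢ a₁ → x ≢ b₁ → ι₁ x ≡ u →
                      (y : V₂) → y ≢ a₂ → y ≢ b₂ → ι₂ y ≡ v → P A ⊎ P B
  walk-meets-A-or-B here x xa xb p y ya yb q = ⊥-elim (ι₁≢ι₂ˡ xa xb (trans p (sym q)))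
  walk-meets-A-or-B (step {v = w} pw e r) x xa xb p y ya yb q with position w
  ... | atA eq = inj₁ (subst _ (sym eq) pw)
  ... | atB eq = inj₂ (subst _ (sym eq) pw)
  ... | inner₁ x' xa' xb' eq = walk-meets-A-or-B r x' xa' xb' eq y ya yb q
  ... | inner₂ y' ya' yb' eq rewrite sym p | sym eq = ⊥-elim (no-inner-edge xa xb ya' yb' e)

  IsEnd₁ : V₁ → Set
  IsEnd₁ z = z ≡ a₁ ⊎ z ≡ b₁

  IsEnd₁? : ∀ z → Dec (IsEnd₁ z)
  IsEnd₁? z with z ≟₁ a₁
  ... | yes p = yes (inj₁ p)
  ... | no na with z ≟₁ b₁
  ...   | yes p = yes (inj₂ p)
  ...   | no nb = no λ { (inj₁ p) → na p ; (inj₂ p) → nb p }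

  IsEnd₁-edge : ∀ {z w} → IsEnd₁ z → IsEnd₁ w → z ≡ w ⊎ E₁ z w
  IsEnd₁-edge (inj₁ refl) (inj₁ refl) = inj₁ refl
  IsEnd₁-edge (inj₁ refl) (inj₂ refl) = inj₂ a₁b₁
  IsEnd₁-edge (inj₂ refl) (inj₁ refl) = inj₂ (E₁-sym a₁b₁)
  IsEnd₁-edge (inj₂ refl) (inj₂ refl) = inj₁ refl

  fold₂ : V₁ → V₂ → V₁
  fold₂ t y with y ≟₂ a₂
  ... | yes _ = a₁
  ... | no _ with y ≟₂ b₂
  ...   | yes _ = b₁
  ...   | no _ = t

  fold₂-a : ∀ t → fold₂ t a₂ ≡ a₁
  fold₂-a t with a₂ ≟₂ a₂
  ... | yes _ = refl
  ... | no n = ⊥-elim (n refl)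

  fold₂-b : ∀ t → fold₂ t b₂ ≡ b₁
  fold₂-b t with b₂ ≟₂ a₂
  ... | yes e = ⊥-elim (a₂≢b₂ (sym e))
  ... | no _ with b₂ ≟₂ b₂
  ...   | yes _ = refl
  ...   | no n = ⊥-elim (n refl)

  fold₂-inner : ∀ t y → y ≢ a₂ → y ≢ b₂ → fold₂ t y ≡ t
  fold₂-inner t y ya yb with y ≟₂ a₂
  ... | yes e = ⊥-elim (ya e)
  ... | no _ with y ≟₂ b₂
  ...   | yes e = ⊥-elim (yb e)
  ...   | no _ = refl

  fold₂-IsEnd₁ : ∀ t → IsEnd₁ t → ∀ y → IsEnd₁ (fold₂ t y)
  fold₂-IsEnd₁ t ht y with y ≟₂ a₂
  ... | yes _ = inj₁ refl
  ... | no _ with y ≟₂ b₂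
  ...   | yes _ = inj₂ refl
  ...   | no _ = ht

  -- The retraction of G onto G₁ sending the interior of side 2 to t.
  projectAt : V₁ → ∀ {v} → Position v → V₁
  projectAt t (inner₁ x _ _ _) = x
  projectAt t (inner₂ _ _ _ _) = t
  projectAt t (atA _) = a₁
  projectAt t (atB _) = b₁

  project : V₁ → V → V₁
  project t v = projectAt t (position v)

  project-ι₁ : ∀ t x → project t (ι₁ x) ≡ x
  project-ι₁ t x = go (position (ι₁ x))
    where
    go : (s : Position (ι₁ x)) → projectAt t s ≡ x
    go (inner₁ _ _ _ eq) = ι₁-injective eq
    go (inner₂ _ ya yb eq) = ⊥-elim (ι₁≢ι₂ʳ ya yb (sym eq))
    go (atA eq) = ι₁-injective eq
    go (atB eq) = ι₁-injective eq

  project-ι₂ : ∀ t y → project t (ι₂ y) ≡ fold₂ t y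
  project-ι₂ t y = go (position (ι₂ y))
    where
    go : (s : Position (ι₂ y)) → projectAt t s ≡ fold₂ t y
    go (inner₁ _ xa xb eq) = ⊥-elim (ι₁≢ι₂ˡ xa xb eq)
    go (inner₂ y' ya yb eq) with ι₂-injective eq
    ... | refl = sym (fold₂-inner t y' ya yb)
    go (atA eq) with ι-meet eq
    ... | inj₁ (_ , refl) = sym (fold₂-a t)
    ... | inj₂ (p , _) = ⊥-elim (a₁≢b₁ p)
    go (atB eq) with ι-meet eq
    ... | inj₁ (p , _) = ⊥-elim (a₁≢b₁ (sym p))
    ... | inj₂ (_ , refl) = sym (fold₂-b t)

  project-edgeMap : ∀ t → IsEnd₁ t → EdgeMap E E₁ (project t)
  project-edgeMap t ht e with E-reflect e
  ... | inj₁ (x , y , refl , refl , e₁) rewrite project-ι₁ t x | project-ι₁ t y = inj₂ e₁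
  ... | inj₂ (x , y , refl , refl , e₂) rewrite project-ι₂ t x | project-ι₂ t y =
    IsEnd₁-edge (fold₂-IsEnd₁ t ht x) (fold₂-IsEnd₁ t ht y)

  ι₁-projectAt : ∀ t {v} (s : Position v) → (∀ y → y ≢ a₂ → y ≢ b₂ → ι₂ y ≢ v) → ι₁ (projectAt t s) ≡ v
  ι₁-projectAt t (inner₁ x _ _ eq) n = eq
  ι₁-projectAt t (inner₂ y ya yb eq) n = ⊥-elim (n y ya yb eq)
  ι₁-projectAt t (atA eq) n = eq
  ι₁-projectAt t (atB eq) n = eq

  ι₁-project : ∀ t v → (∀ y → y ≢ a₂ → y ≢ b₂ → ι₂ y ≢ v) → ι₁ (project t v) ≡ v
  ι₁-project t v = ι₁-projectAt t (position v)

  inner⇒¬IsEnd₁ : ∀ {x} → x ≢ a₁ → x ≢ b₁ → ¬ IsEnd₁ x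
  inner⇒¬IsEnd₁ xa xb (inj₁ p) = xa p
  inner⇒¬IsEnd₁ xa xb (inj₂ p) = xb p

  E₁-embedˡ : ∀ {x y} → ¬ IsEnd₁ x → E₁ x y → E (ι₁ x) (ι₁ y)
  E₁-embedˡ nx e = E₁-embed e (λ { (p , _) → nx (inj₁ p) }) (λ { (p , _) → nx (inj₂ p) })

  walkToEnd₁ : (Q : V → Set) → Connected E₁ (λ z → Q (ι₁ z)) →
               ∀ x → x ≢ a₁ → x ≢ b₁ → Q (ι₁ x) → ∀ t → IsEnd₁ t → Q (ι₁ t) →
               Σ V₁ λ h → IsEnd₁ h × Walk E Q (ι₁ x) (ι₁ h)
  walkToEnd₁ Q c x xa xb qx t ht qt
    with firstEntry IsEnd₁ IsEnd₁? (c x t qx qt) ht (inner⇒¬IsEnd₁ xa xb)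
  ... | y , h , w , e , th , qh =
    h , th , snocʷ (mapʷ ι₁ inner-edge proj₁ (qx , inner⇒¬IsEnd₁ xa xb) w) qh (E₁-embedˡ y-inner e)
    where
    inner-edge : WeakHom E₁ E (λ z → Q (ι₁ z) × ¬ IsEnd₁ z) ι₁
    inner-edge (_ , np) _ e' = inj₂ (E₁-embedˡ np e')
    y-inner : ¬ IsEnd₁ y
    y-inner = proj₂ (Walk-end (qx , inner⇒¬IsEnd₁ xa xb) w)

  -- G₂ - b₂ and G₂ - a₂ give walks a₂ → c₂ → b₂ avoiding the edge a₂b₂.
  detour₂ : (Q : V → Set) → (∀ y → Q (ι₂ y)) → TwoConnected E₂ (λ _ → ⊤) → Walk E Q A B
  detour₂ Q q₂ (_ , _ , cut) =
    subst₂ (Walk E Q) (sym ι-a) (sym ι-b)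
      (mapʷ ι₂ avoid-b (λ _ → q₂ _) (tt , a₂≢b₂) (cut b₂ tt a₂ c₂ (tt , a₂≢b₂) (tt , c₂≢b₂))
       ++ʷ mapʷ ι₂ avoid-a (λ _ → q₂ _) (tt , c₂≢a₂) (cut a₂ tt c₂ b₂ (tt , c₂≢a₂) (tt , λ e → a₂≢b₂ (sym e))))
    where
    avoid-b : WeakHom E₂ E (λ p → ⊤ × p ≢ b₂) ι₂
    avoid-b (_ , pz) (_ , qz) e = inj₂ (E₂-embed e (λ { (_ , r) → qz r }) (λ { (r , _) → pz r }))
    avoid-a : WeakHom E₂ E (λ p → ⊤ × p ≢ a₂) ι₂
    avoid-a (_ , pz) (_ , qz) e = inj₂ (E₂-embed e (λ { (r , _) → pz r }) (λ { (_ , r) → qz r }))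

-- mw = nothing: no vertex is deleted; the ⊤ factor matches the vertex set of G - w in TwoConnected.
Survives : {V : Set} → Maybe V → V → Set
Survives nothing x = ⊤
Survives (just w) x = ⊤ × x ≢ w

survives-one-of : {V : Set} → ((x y : V) → Dec (x ≡ y)) →
                  ∀ mw {p q : V} → p ≢ q → Survives mw p ⊎ Survives mw q
survives-one-of _≟′_ nothing p≢q = inj₁ tt
survives-one-of _≟′_ (just w) {p} p≢q with p ≟′ w
... | yes refl = inj₂ (tt , λ e → p≢q (sym e))
... | no p≢w = inj₁ (tt , p≢w)

module HalfGluing (g : Gluing) (tc₁ : TwoConnected (Gluing.E₁ g) (λ _ → ⊤)) where
  open Gluing g
  open Sides g

  A≢B : A ≢ B
  A≢B e = a₁≢b₁ (ι₁-injective e)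

  delete₁ : ∀ {w} z → ι₁ z ≡ w → Connected E₁ (λ x → Survives (just w) (ι₁ x))
  delete₁ z eq = Connected-mono (λ { (_ , n) → tt , λ e → n (ι₁-injective (trans e (sym eq))) })
                                (λ { (_ , n) → tt , λ e → n (trans (cong ι₁ e) eq) })
                                (proj₂ (proj₂ tc₁) z tt)

  survivors₁-connected : ∀ mw → Connected E₁ (λ z → Survives mw (ι₁ z))
  survivors₁-connected nothing = proj₁ (proj₂ tc₁)
  survivors₁-connected (just w) with position w
  ... | inner₁ z _ _ eq = delete₁ z eq
  ... | atA eq = delete₁ a₁ eq
  ... | atB eq = delete₁ b₁ eq
  ... | inner₂ _ ya yb eq =
    Connected-mono (λ _ → tt , λ e → ι₁≢ι₂ʳ ya yb (trans e (sym eq))) (λ _ → tt) (proj₁ (proj₂ tc₁))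

  inner₁-toEnd : ∀ mw x → x ≢ a₁ → x ≢ b₁ → Survives mw (ι₁ x) →
                 Σ V₁ λ h → IsEnd₁ h × Walk E (Survives mw) (ι₁ x) (ι₁ h)
  inner₁-toEnd mw x xa xb q with survives-one-of _≟V_ mw A≢B
  ... | inj₁ qa = walkToEnd₁ (Survives mw) (survivors₁-connected mw) x xa xb q a₁ (inj₁ refl) qa
  ... | inj₂ qb = walkToEnd₁ (Survives mw) (survivors₁-connected mw) x xa xb q b₁ (inj₂ refl) qb

module GluedTwoConnected (g : Gluing)
                         (tc₁ : TwoConnected (Gluing.E₁ g) (λ _ → ⊤))
                         (tc₂ : TwoConnected (Gluing.E₂ g) (λ _ → ⊤)) where
  open Gluing g
  open Sides g
  open HalfGluing g tc₁
  module S₂ = Sides (swap g)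
  module H₂ = HalfGluing (swap g) tc₂

  toEnd : ∀ mw v → Survives mw v → Σ V₁ λ h → IsEnd₁ h × Walk E (Survives mw) v (ι₁ h)
  toEnd mw v q with position v
  ... | atA eq = a₁ , inj₁ refl , subst (Walk E (Survives mw) v) (sym eq) here
  ... | atB eq = b₁ , inj₂ refl , subst (Walk E (Survives mw) v) (sym eq) here
  ... | inner₁ x xa xb refl = inner₁-toEnd mw x xa xb q
  ... | inner₂ y ya yb refl = toEnd₂ (H₂.inner₁-toEnd mw y ya yb q)
    where
    toEnd₂ : (Σ V₂ λ h → S₂.IsEnd₁ h × Walk E (Survives mw) (ι₂ y) (ι₂ h)) →
             Σ V₁ λ h → IsEnd₁ h × Walk E (Survives mw) (ι₂ y) (ι₁ h)
    toEnd₂ (_ , inj₁ refl , w) = a₁ , inj₁ refl , subst (Walk E (Survives mw) (ι₂ y)) (sym ι-a) w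
    toEnd₂ (_ , inj₂ refl , w) = b₁ , inj₂ refl , subst (Walk E (Survives mw) (ι₂ y)) (sym ι-b) w

  one-side-intact : ∀ mw → Survives mw A → Survives mw B →
                    (∀ y → Survives mw (ι₂ y)) ⊎ (∀ x → Survives mw (ι₁ x))
  one-side-intact nothing _ _ = inj₁ (λ _ → tt)
  one-side-intact (just w) qa qb with position w
  ... | inner₁ _ xa xb eq = inj₁ (λ y → tt , λ e → ι₁≢ι₂ˡ xa xb (trans eq (sym e)))
  ... | inner₂ _ ya yb eq = inj₂ (λ x → tt , λ e → ι₁≢ι₂ʳ ya yb (trans e (sym eq)))
  ... | atA eq = ⊥-elim (proj₂ qa eq)
  ... | atB eq = ⊥-elim (proj₂ qb eq)

  A⇝B : ∀ mw → Survives mw A → Survives mw B → Walk E (Survives mw) A B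
  A⇝B mw qa qb with one-side-intact mw qa qb
  ... | inj₁ side₂ = detour₂ (Survives mw) side₂ tc₂
  ... | inj₂ side₁ = subst₂ (Walk E (Survives mw)) (sym ι-a) (sym ι-b) (S₂.detour₂ (Survives mw) side₁ tc₁)

  survivors-connected : ∀ mw → Connected E (Survives mw)
  survivors-connected mw with survives-one-of _≟V_ mw A≢B
  ... | inj₁ qa = Connected-viaHub E-sym A toA
    where
    toA : ∀ x → Survives mw x → Walk E (Survives mw) x A
    toA x q with toEnd mw x q
    ... | _ , inj₁ refl , w = w
    ... | _ , inj₂ refl , w = w ++ʷ reverseʷ E-sym qa (A⇝B mw qa (Walk-end q w))
  ... | inj₂ qb = Connected-viaHub E-sym B toB
    where
    toB : ∀ x → Survives mw x → Walk E (Survives mw) x B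
    toB x q with toEnd mw x q
    ... | _ , inj₂ refl , w = w
    ... | _ , inj₁ refl , w = w ++ʷ A⇝B mw (Walk-end q w) qb

  twoConnected : TwoConnected E (λ _ → ⊤)
  twoConnected = (A , B , tt , tt , A≢B) , survivors-connected nothing , λ w _ → survivors-connected (just w)

-- Good flats of a gluing

-- Since P misses the interior of side 2, projecting G onto G₁ retracts P onto P₁ and G/P onto G₁/P₁.
module FlatOnSide₁ (g : Gluing) (P : Gluing.V g → Set) (P? : ∀ v → Dec (P v))
                   (flat : IsGoodFlat (Gluing.E g) P)
                   (¬AB : ¬ (P (Sides.A g) × P (Sides.B g)))
                   (¬inner₂ : ∀ y → y ≢ Gluing.a₂ g → y ≢ Gluing.b₂ g → ¬ P (Gluing.ι₂ g y)) where
  open Gluing g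
  open Sides g

  P₁ : V₁ → Set
  P₁ x = P (ι₁ x)

  open Collapse (λ x → P? (ι₁ x))

  ι₁-project-P : ∀ t {x} → P x → ι₁ (project t x) ≡ x
  ι₁-project-P t {x} px = ι₁-project t x (λ y ya yb e → ¬inner₂ y ya yb (subst P (sym e) px))

  project-P : ∀ t {x} → P x → P₁ (project t x)
  project-P t px = subst P (sym (ι₁-project-P t px)) px

  restrict-twoConnected : TwoConnected E₁ P₁
  restrict-twoConnected =
    TwoConnected-retract (λ _ → project a₁) ι₁ pair (λ _ _ → project-edgeMap a₁ (inj₁ refl))
      (project-P a₁) (λ p → p) (λ {_} {w} _ → project-ι₁ a₁ w)
      (λ _ px ne eq → ne (trans (sym (ι₁-project-P a₁ px)) (cong ι₁ eq))) (proj₁ flat)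
    where
    pair : Σ V₁ λ u → Σ V₁ λ v → P₁ u × P₁ v × u ≢ v
    pair with proj₁ (proj₁ flat)
    ... | u , v , pu , pv , u≢v =
      project a₁ u , project a₁ v , project-P a₁ pu , project-P a₁ pv ,
      λ e → u≢v (trans (sym (ι₁-project-P a₁ pu)) (trans (cong ι₁ e) (ι₁-project-P a₁ pv)))

  collapse-a≢b : collapse a₁ ≢ collapse b₁
  collapse-a≢b e with collapse-cases a₁ | collapse-cases b₁
  ... | inj₁ (pa , _) | inj₁ (pb , _) = ¬AB (pa , pb)
  ... | inj₁ (_ , p) | inj₂ (_ , q) with () ← trans (sym p) (trans e q)
  ... | inj₂ (_ , p) | inj₁ (_ , q) with () ← trans (sym q) (trans (sym e) p)
  ... | inj₂ (_ , p) | inj₂ (_ , q) = a₁≢b₁ (just-injective (trans (sym p) (trans e q)))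

  -- The end of e₁ to which the interior of side 2 is projected; after contraction it must
  -- differ from the deleted vertex, and one of a₁, b₁ always does.
  endFor : Maybe (Maybe V₁) → V₁
  endFor nothing = a₁
  endFor (just w) with ≡-dec _≟₁_ (collapse a₁) w
  ... | yes _ = b₁
  ... | no _ = a₁

  endFor-IsEnd₁ : ∀ k → IsEnd₁ (endFor k)
  endFor-IsEnd₁ nothing = inj₁ refl
  endFor-IsEnd₁ (just w) with ≡-dec _≟₁_ (collapse a₁) w
  ... | yes _ = inj₂ refl
  ... | no _ = inj₁ refl

  endFor-avoids : ∀ w → collapse (endFor (just w)) ≢ w
  endFor-avoids w with ≡-dec _≟₁_ (collapse a₁) w
  ... | yes p = λ q → collapse-a≢b (trans p (sym q))
  ... | no n = n

  contractProject : Maybe (Maybe V₁) → Maybe V → Maybe V₁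
  contractProject k x = x >>= λ u → collapse (project (endFor k) u)

  outside-avoids : ∀ w {u} z → ι₁ z ≡ u → ¬ P u → just u ≢ Maybe.map ι₁ w → collapse z ≢ w
  outside-avoids w z zu nu ne eq =
    ne (trans (cong just (sym zu)) (cong (Maybe.map ι₁) (trans (sym (collapse-out (λ pz → nu (subst P zu pz)))) eq)))

  projectAt-avoids : ∀ w {u} (s : Position u) → ¬ P u → just u ≢ Maybe.map ι₁ w →
                     collapse (projectAt (endFor (just w)) s) ≢ w
  projectAt-avoids w (inner₂ _ _ _ _) _ _ = endFor-avoids w
  projectAt-avoids w (inner₁ z _ _ zu) = outside-avoids w z zu
  projectAt-avoids w (atA zu) = outside-avoids w a₁ zu
  projectAt-avoids w (atB zu) = outside-avoids w b₁ zu

  restrict-contractTwoConnected : TwoConnected (Contract E₁ P₁) (ContractVert P₁)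
  restrict-contractTwoConnected =
    TwoConnected-retract contractProject (Maybe.map ι₁) pair
      (λ {k} {x} {y} _ _ e → collapse-edgeMap {E' = E₁} (project (endFor k)) (project-edgeMap (endFor k) (endFor-IsEnd₁ k))
                                    (project-P (endFor k)) {x} {y} e)
      (λ { {k} {nothing} _ → tt ; {k} {just u} _ → collapse-vert (project (endFor k) u) })
      (λ { {nothing} _ → tt ; {just y} n → n })
      (λ { {k} {nothing} _ → refl ; {k} {just y} n → trans (cong collapse (project-ι₁ (endFor k) y)) (collapse-out n) })
      avoid
      (proj₂ flat)
    where
    pair : Σ (Maybe V₁) λ u → Σ (Maybe V₁) λ v → ContractVert P₁ u × ContractVert P₁ v × u ≢ v
    pair with P? A
    ... | no na = nothing , just a₁ , tt , na , λ ()
    ... | yes pa = nothing , just b₁ , tt , (λ pb → ¬AB (pa , pb)) , λ ()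
    avoid : ∀ {w x} → ContractVert P₁ w → ContractVert P x → x ≢ Maybe.map ι₁ w → contractProject (just w) x ≢ w
    avoid {nothing} {nothing} _ _ ne _ = ne refl
    avoid {just y} {nothing} _ _ ne ()
    avoid {w} {just u} _ nu ne = projectAt-avoids w (position u) nu ne

  restrict-goodFlat : IsGoodFlat E₁ P₁
  restrict-goodFlat = restrict-twoConnected , restrict-contractTwoConnected

-- Since P contains side 1, projecting G onto G₂ retracts P onto P₂ and G/P onto G₂/P₂.
module FlatOnSide₂ (g : Gluing) (P : Gluing.V g → Set) (P? : ∀ v → Dec (P v))
                   (flat : IsGoodFlat (Gluing.E g) P)
                   (side₁ : ∀ x → P (Gluing.ι₁ g x)) where
  open Gluing g
  open Sides (swap g)

  P₂ : V₂ → Set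
  P₂ y = P (ι₂ y)

  Pa : P₂ a₂
  Pa = subst P ι-a (side₁ a₁)

  Pb : P₂ b₂
  Pb = subst P ι-b (side₁ b₁)

  open Collapse (λ y → P? (ι₂ y))

  projectAt-P : ∀ t → IsEnd₁ t → ∀ {x} (s : Position x) → P x → P₂ (projectAt t s)
  projectAt-P t _ (inner₁ _ _ _ eq) px = subst P (sym eq) px
  projectAt-P t (inj₁ refl) (inner₂ _ _ _ _) _ = Pa
  projectAt-P t (inj₂ refl) (inner₂ _ _ _ _) _ = Pb
  projectAt-P t _ (atA eq) px = subst P (sym eq) px
  projectAt-P t _ (atB eq) px = subst P (sym eq) px

  project-P : ∀ t → IsEnd₁ t → ∀ {x} → P x → P₂ (project t x)
  project-P t ht {x} = projectAt-P t ht (position x)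

  endFor : Maybe V₂ → V₂
  endFor nothing = a₂
  endFor (just w) with w ≟₂ a₂
  ... | yes _ = b₂
  ... | no _ = a₂

  endFor-IsEnd₁ : ∀ k → IsEnd₁ (endFor k)
  endFor-IsEnd₁ nothing = inj₁ refl
  endFor-IsEnd₁ (just w) with w ≟₂ a₂
  ... | yes _ = inj₂ refl
  ... | no _ = inj₁ refl

  endFor-avoids : ∀ w → endFor (just w) ≢ w
  endFor-avoids w with w ≟₂ a₂
  ... | yes refl = λ e → a₂≢b₂ (sym e)
  ... | no n = λ e → n (sym e)

  projectAt-avoids : ∀ w {x} (s : Position x) → x ≢ ι₂ w → projectAt (endFor (just w)) s ≢ w
  projectAt-avoids w (inner₁ _ _ _ eq) ne e = ne (trans (sym eq) (cong ι₂ e))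
  projectAt-avoids w (inner₂ _ _ _ _) ne e = endFor-avoids w e
  projectAt-avoids w (atA eq) ne e = ne (trans (sym eq) (cong ι₂ e))
  projectAt-avoids w (atB eq) ne e = ne (trans (sym eq) (cong ι₂ e))

  restrict-twoConnected : TwoConnected E₂ P₂
  restrict-twoConnected =
    TwoConnected-retract (λ k → project (endFor k)) ι₂ (a₂ , b₂ , Pa , Pb , a₂≢b₂)
      (λ {k} _ _ → project-edgeMap (endFor k) (endFor-IsEnd₁ k))
      (λ {k} → project-P (endFor k) (endFor-IsEnd₁ k)) (λ p → p) (λ {k} {w} _ → project-ι₁ (endFor k) w)
      (λ {w} {x} _ _ ne → projectAt-avoids w (position x) ne) (proj₁ flat)

  -- Outside P only the interior of side 2 remains.
  outside : ∀ {u} (s : Position u) → ¬ P u → Σ V₂ λ y → ι₂ y ≡ u × projectAt a₂ s ≡ y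
  outside (inner₁ y _ _ eq) _ = y , eq , refl
  outside (inner₂ x _ _ eq) n = ⊥-elim (n (subst P eq (side₁ x)))
  outside (atA eq) n = ⊥-elim (n (subst P eq Pa))
  outside (atB eq) n = ⊥-elim (n (subst P eq Pb))

  contractProject : Maybe V → Maybe V₂
  contractProject x = x >>= λ u → collapse (project a₂ u)

  restrict-contractTwoConnected : TwoConnected (Contract E₂ P₂) (ContractVert P₂)
  restrict-contractTwoConnected =
    TwoConnected-retract (λ _ → contractProject) (Maybe.map ι₂) pair
      (λ {k} {x} {y} _ _ e → collapse-edgeMap {E' = E₂} (project a₂) (project-edgeMap a₂ (inj₁ refl))
                                               (project-P a₂ (inj₁ refl)) {x} {y} e)
      (λ { {k} {nothing} _ → tt ; {k} {just u} _ → collapse-vert (project a₂ u) })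
      (λ { {nothing} _ → tt ; {just y} n → n })
      (λ { {k} {nothing} _ → refl ; {k} {just y} n → trans (cong collapse (project-ι₁ a₂ y)) (collapse-out n) })
      avoid
      (proj₂ flat)
    where
    pairFrom : ∀ z → ¬ P z → Σ (Maybe V₂) λ u → Σ (Maybe V₂) λ v → ContractVert P₂ u × ContractVert P₂ v × u ≢ v
    pairFrom z n with outside (position z) n
    ... | y , refl , _ = nothing , just y , tt , n , λ ()
    pair : Σ (Maybe V₂) λ u → Σ (Maybe V₂) λ v → ContractVert P₂ u × ContractVert P₂ v × u ≢ v
    pair with proj₁ (proj₂ flat)
    ... | just z , _ , n , _ , _ = pairFrom z n
    ... | nothing , just z , _ , n , _ = pairFrom z n
    ... | nothing , nothing , _ , _ , ne = ⊥-elim (ne refl)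
    avoid : ∀ {w x} → ContractVert P₂ w → ContractVert P x → x ≢ Maybe.map ι₂ w → contractProject x ≢ w
    avoid {nothing} {nothing} _ _ ne _ = ne refl
    avoid {just y} {nothing} _ _ ne ()
    avoid {w} {just u} _ nu ne eq with outside (position u) nu
    ... | y , yu , p =
      ne (trans (cong just (sym yu)) (cong (Maybe.map ι₂)
           (trans (sym (collapse-out (λ py → nu (subst P yu py)))) (trans (cong collapse (sym p)) eq))))

  restrict-goodFlat : IsGoodFlat E₂ P₂
  restrict-goodFlat = restrict-twoConnected , restrict-contractTwoConnected

module Separation (g : Gluing) where
  open Gluing g
  open Sides g

  -- Delete whichever of A, B lies in P; a walk in P from side 1 to side 2 still meets A or B.
  no-straddle : ∀ (P : V → Set) (P? : ∀ v → Dec (P v)) → TwoConnected E P → ¬ (P A × P B) →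
                ∀ x → x ≢ a₁ → x ≢ b₁ → P (ι₁ x) → ∀ y → y ≢ a₂ → y ≢ b₂ → ¬ P (ι₂ y)
  no-straddle P P? (_ , c , cut) ¬AB x xa xb px y ya yb py with P? A | P? B
  ... | yes pa | _ with walk-meets-A-or-B (cut A pa (ι₁ x) (ι₂ y) (px , λ e → xa (ι₁-injective e))
                                                                  (py , λ e → ι₁≢ι₂ʳ ya yb (sym e)))
                                          x xa xb refl y ya yb refl
  ...   | inj₁ (_ , A≢A) = A≢A refl
  ...   | inj₂ (pb , _) = ¬AB (pa , pb)
  no-straddle P P? (_ , c , cut) ¬AB x xa xb px y ya yb py | no na | yes pb
    with walk-meets-A-or-B (cut B pb (ι₁ x) (ι₂ y) (px , λ e → xb (ι₁-injective e))
                                                    (py , λ e → ι₁≢ι₂ʳ ya yb (sym e)))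
                           x xa xb refl y ya yb refl
  ...   | inj₁ (pa , _) = na pa
  ...   | inj₂ (_ , B≢B) = B≢B refl
  no-straddle P P? (_ , c , cut) ¬AB x xa xb px y ya yb py | no na | no nb
    with walk-meets-A-or-B (c (ι₁ x) (ι₂ y) px py) x xa xb refl y ya yb refl
  ...   | inj₁ pa = na pa
  ...   | inj₂ pb = nb pb

  -- Outside vertices on different sides are joined outside P (G/P - P is connected),
  -- so a good flat through A and B missing an inner vertex of side 1 contains side 2.
  side₂-inside : ∀ (P : V → Set) (P? : ∀ v → Dec (P v)) → IsGoodFlat E P → P A → P B →
                 ∀ x → x ≢ a₁ → x ≢ b₁ → ¬ P (ι₁ x) → ∀ y → P (ι₂ y)
  side₂-inside P P? flat pa pb x xa xb nx y with P? (ι₂ y)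
  ... | yes p = p
  ... | no n with y ≟₂ a₂
  ...   | yes refl = ⊥-elim (n (subst P ι-a pa))
  ...   | no ya with y ≟₂ b₂
  ...     | yes refl = ⊥-elim (n (subst P ι-b pb))
  ...     | no yb with walk-meets-A-or-B (unContractʷ {E = E} {P = P} nx
                         (proj₂ (proj₂ (proj₂ flat)) nothing tt (just (ι₁ x)) (just (ι₂ y)) (nx , λ ()) (n , λ ())))
                         x xa xb refl y ya yb refl
  ...       | inj₁ q = ⊥-elim (q pa)
  ...       | inj₂ q = ⊥-elim (q pb)

only-ends : ∀ {W : Set} → ((x y : W) → Dec (x ≡ y)) → ∀ {Q : W → Set} {a b : W} →
            (∀ y → y ≢ a → y ≢ b → ¬ Q y) → ∀ y → Q y → y ≡ a ⊎ y ≡ b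
only-ends _≟′_ {a = a} {b} f y qy with y ≟′ a
... | yes e = inj₁ e
... | no ya with y ≟′ b
...   | yes e = inj₂ e
...   | no yb = ⊥-elim (f y ya yb qy)

module Classification (g : Gluing) where
  open Gluing g
  open Sides g
  open Separation g
  module Sep₂ = Separation (swap g)

  data Shape (P : V → Set) : Set where
    within₁  : ¬ (P A × P B) → (∀ y → y ≢ a₂ → y ≢ b₂ → ¬ P (ι₂ y)) → Shape P
    within₂  : ¬ (P A × P B) → (∀ x → x ≢ a₁ → x ≢ b₁ → ¬ P (ι₁ x)) → Shape P
    covers₁ : (∀ x → P (ι₁ x)) → Shape P
    covers₂ : (∀ y → P (ι₂ y)) → Shape P

  module _ (P : V → Set) (P? : ∀ v → Dec (P v)) (flat : IsGoodFlat E P) where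

    ¬AB₂ : ¬ (P A × P B) → ¬ (P (ι₂ a₂) × P (ι₂ b₂))
    ¬AB₂ n (p , q) = n (subst P (sym ι-a) p , subst P (sym ι-b) q)

    from-inner₁ : ¬ (P A × P B) → ∀ x → x ≢ a₁ → x ≢ b₁ → P (ι₁ x) → Shape P
    from-inner₁ n x xa xb px = within₁ n (no-straddle P P? (proj₁ flat) n x xa xb px)

    from-inner₂ : ¬ (P A × P B) → ∀ y → y ≢ a₂ → y ≢ b₂ → P (ι₂ y) → Shape P
    from-inner₂ n y ya yb py = within₂ n (λ x xa xb px → Sep₂.no-straddle P P? (proj₁ flat) (¬AB₂ n) y ya yb py x xa xb px)

    from-inside : ¬ (P A × P B) → ∀ {u} → P u → Position u → Shape P ⊎ (A ≡ u ⊎ B ≡ u)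
    from-inside n pu (inner₁ x xa xb e) = inj₁ (from-inner₁ n x xa xb (subst P (sym e) pu))
    from-inside n pu (inner₂ y ya yb e) = inj₁ (from-inner₂ n y ya yb (subst P (sym e) pu))
    from-inside n pu (atA e) = inj₂ (inj₁ e)
    from-inside n pu (atB e) = inj₂ (inj₂ e)

    -- A 2-connected P has two vertices, which cannot both be ends unless P ⊇ {A, B}.
    shape-¬AB : ¬ (P A × P B) → Shape P
    shape-¬AB n with proj₁ (proj₁ flat)
    ... | u , v , pu , pv , u≢v with from-inside n pu (position u) | from-inside n pv (position v)
    ...   | inj₁ s | _ = s
    ...   | inj₂ _ | inj₁ s = s
    ...   | inj₂ (inj₁ e) | inj₂ (inj₁ e') = ⊥-elim (u≢v (trans (sym e) e'))
    ...   | inj₂ (inj₁ e) | inj₂ (inj₂ e') = ⊥-elim (n (subst P (sym e) pu , subst P (sym e') pv))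
    ...   | inj₂ (inj₂ e) | inj₂ (inj₁ e') = ⊥-elim (n (subst P (sym e') pv , subst P (sym e) pu))
    ...   | inj₂ (inj₂ e) | inj₂ (inj₂ e') = ⊥-elim (u≢v (trans (sym e) e'))

    shape-outside : P A → P B → ∀ z → ¬ P z → Shape P
    shape-outside pa pb z nz with position z
    ... | atA eq = ⊥-elim (nz (subst P eq pa))
    ... | atB eq = ⊥-elim (nz (subst P eq pb))
    ... | inner₁ x xa xb refl = covers₂ (side₂-inside P P? flat pa pb x xa xb nz)
    ... | inner₂ y ya yb refl = covers₁ (Sep₂.side₂-inside P P? flat (subst P ι-a pa) (subst P ι-b pb) y ya yb nz)

    -- If A, B ∈ P, the second vertex of the 2-connected G/P is some z ∉ P.
    shape : Shape P
    shape with P? A | P? B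
    shape | yes pa | yes pb with proj₁ (proj₂ flat)
    ... | just z , _ , nz , _ , _ = shape-outside pa pb z nz
    ... | nothing , just z , _ , nz , _ = shape-outside pa pb z nz
    ... | nothing , nothing , _ , _ , ne = ⊥-elim (ne refl)
    shape | yes pa | no nb = shape-¬AB (λ { (_ , q) → nb q })
    shape | no na | _ = shape-¬AB (λ { (p , _) → na p })

  data FlatCase (P : V → Set) : Set where
    inside₁ : ¬ (P A × P B) → (∀ y → P (ι₂ y) → y ≡ a₂ ⊎ y ≡ b₂) → IsGoodFlat E₁ (λ x → P (ι₁ x)) → FlatCase P
    inside₂ : ¬ (P A × P B) → (∀ x → P (ι₁ x) → x ≡ a₁ ⊎ x ≡ b₁) → IsGoodFlat E₂ (λ y → P (ι₂ y)) → FlatCase P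
    over₁ : (∀ x → P (ι₁ x)) → IsGoodFlat E₂ (λ y → P (ι₂ y)) → FlatCase P
    over₂ : (∀ y → P (ι₂ y)) → IsGoodFlat E₁ (λ x → P (ι₁ x)) → FlatCase P

  classify : ∀ (P : V → Set) (P? : ∀ v → Dec (P v)) → IsGoodFlat E P → FlatCase P
  classify P P? flat with shape P P? flat
  ... | within₁ n f = inside₁ n (only-ends _≟₂_ f) (FlatOnSide₁.restrict-goodFlat g P P? flat n f)
  ... | within₂ n f = inside₂ n (only-ends _≟₁_ f) (FlatOnSide₁.restrict-goodFlat (swap g) P P? flat (¬AB₂ P P? flat n) f)
  ... | covers₁ f = over₁ f (FlatOnSide₂.restrict-goodFlat g P P? flat f)
  ... | covers₂ f = over₂ f (FlatOnSide₂.restrict-goodFlat (swap g) P P? flat f)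

-- Sums over Fin and edge counts

sum-tabulate : ∀ {n k} (f : Fin k → ℕ) (h : Fin n → Fin k) → listSum (List.map f (List.tabulate h)) ≡ sum (λ i → f (h i))
sum-tabulate {zero} f h = refl
sum-tabulate {suc n} f h = cong (f (h zero) +_) (sum-tabulate f (λ i → h (suc i)))

sum-allFin : ∀ {n} (f : Fin n → ℕ) → listSum (List.map f (List.allFin n)) ≡ sum f
sum-allFin f = sum-tabulate f (λ i → i)

sum-zero : ∀ {n} (f : Fin n → ℕ) → (∀ i → f i ≡ 0) → sum f ≡ 0
sum-zero {n} f z = trans (sum-cong-≗ z) (sum-replicate-zero n)

sum-one : ∀ n → sum {n} (λ _ → 1) ≡ n
sum-one zero = refl
sum-one (suc n) = cong suc (sum-one n)

sum-↑ : ∀ n m (f : Fin (n + m) → ℕ) → sum f ≡ sum (λ i → f (i ↑ˡ m)) + sum (λ j → f (n ↑ʳ j))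
sum-↑ zero m f = refl
sum-↑ (suc n) m f = trans (cong (f zero +_) (sum-↑ n m (λ i → f (suc i)))) (sym (+-assoc (f zero) _ _))

sum-support₁ : ∀ {n} (a : Fin n) (f : Fin n → ℕ) → (∀ i → i ≢ a → f i ≡ 0) → sum f ≡ f a
sum-support₁ {suc n} a f z = begin
  sum f                                ≡⟨ sum-remove {i = a} f ⟩
  f a + sum (λ j → f (punchIn a j))    ≡⟨ cong (f a +_) (sum-zero _ (λ j → z _ (punchInᵢ≢i a j))) ⟩
  f a + 0                              ≡⟨ +-identityʳ _ ⟩
  f a                                  ∎

sum-support₂ : ∀ {n} (a b : Fin n) → a ≢ b → (f : Fin n → ℕ) → (∀ i → i ≢ a → i ≢ b → f i ≡ 0) →
               sum f ≡ f a + f b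
sum-support₂ {suc n} a b a≢b f z = begin
  sum f                                          ≡⟨ sum-remove {i = a} f ⟩
  f a + sum (λ j → f (punchIn a j))              ≡⟨ cong (f a +_) (sum-support₁ (punchOut a≢b) _ z') ⟩
  f a + f (punchIn a (punchOut a≢b))             ≡⟨ cong (λ x → f a + f x) (punchIn-punchOut a≢b) ⟩
  f a + f b                                      ∎
  where
  z' : ∀ j → j ≢ punchOut a≢b → f (punchIn a j) ≡ 0
  z' j ne = z _ (punchInᵢ≢i a j)
                (λ e → ne (punchIn-injective a j (punchOut a≢b) (trans e (sym (punchIn-punchOut a≢b)))))

punchIn-skipOut : ∀ {m} (a b : Fin (suc (suc m))) → a ≢ b → punchIn a (skipOut a b) ≡ b
punchIn-skipOut a b a≢b with a ≟ b
... | yes e = ⊥-elim (a≢b e)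
... | no n = punchIn-punchOut n

sum-emb : ∀ {m} (a b : Fin (suc (suc m))) → a ≢ b → (f : Fin (suc (suc m)) → ℕ) →
          sum f ≡ f a + f b + sum (λ j → f (emb a b j))
sum-emb a b a≢b f = begin
  sum f                                                          ≡⟨ sum-remove {i = a} f ⟩
  f a + sum (λ j → f (punchIn a j))                              ≡⟨ cong (f a +_) (sum-remove {i = skipOut a b} (λ j → f (punchIn a j))) ⟩
  f a + (f (punchIn a (skipOut a b)) + sum (λ j → f (emb a b j)))
    ≡⟨ cong (λ x → f a + (f x + sum (λ j → f (emb a b j)))) (punchIn-skipOut a b a≢b) ⟩
  f a + (f b + sum (λ j → f (emb a b j)))                        ≡⟨ sym (+-assoc (f a) _ _) ⟩
  f a + f b + sum (λ j → f (emb a b j))                          ∎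

emb≢a : ∀ {m} (a b : Fin (suc (suc m))) j → emb a b j ≢ a
emb≢a a b j = punchInᵢ≢i a _

emb≢b : ∀ {m} (a b : Fin (suc (suc m))) → a ≢ b → ∀ j → emb a b j ≢ b
emb≢b a b a≢b j e = punchInᵢ≢i (skipOut a b) j
  (punchIn-injective a _ _ (trans e (sym (punchIn-skipOut a b a≢b))))

emb-injective : ∀ {m} (a b : Fin (suc (suc m))) {j k} → emb a b j ≡ emb a b k → j ≡ k
emb-injective a b {j} {k} e = punchIn-injective (skipOut a b) j k (punchIn-injective a _ _ e)

arcs : ∀ {n} → Graph n → (Fin n → Bool) → ℕ
arcs H p = sum λ i → sum λ j → count01 (p i ∧ p j ∧ H i j)

edges : ∀ {n} → Graph n → (Fin n → Bool) → ℕ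
edges H p = sum λ i → sum λ j → count01 ((toℕ i <ᵇ toℕ j) ∧ p i ∧ p j ∧ H i j)

vertices : ∀ {n} → (Fin n → Bool) → ℕ
vertices p = sum λ i → count01 (p i)

edgesIn≡edges : ∀ {n} (H : Graph n) (S : Subset n) → edgesIn H S ≡ edges H (lookup S)
edgesIn≡edges {n} H S =
  trans (sum-allFin (λ i → listSum (List.map (f i) (List.allFin n)))) (sum-cong-≗ (λ i → sum-allFin (f i)))
  where f : Fin n → Fin n → ℕ
        f i j = count01 ((toℕ i <ᵇ toℕ j) ∧ lookup S i ∧ lookup S j ∧ H i j)

numEdges≡edges : ∀ {n} (H : Graph n) → numEdges H ≡ edges H (λ _ → true)
numEdges≡edges {n} H =
  trans (sum-allFin (λ i → listSum (List.map (f i) (List.allFin n)))) (sum-cong-≗ (λ i → sum-allFin (f i)))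
  where f : Fin n → Fin n → ℕ
        f i j = count01 ((toℕ i <ᵇ toℕ j) ∧ H i j)

∣∣≡vertices : ∀ {n} (S : Subset n) → ∣ S ∣ ≡ vertices (lookup S)
∣∣≡vertices [] = refl
∣∣≡vertices (true ∷ S) = cong suc (∣∣≡vertices S)
∣∣≡vertices (false ∷ S) = ∣∣≡vertices S

module _ {n} (H : Graph n) (simple : IsSimple H) (p : Fin n → Bool) where

  private
    X : Fin n → Fin n → Bool
    X i j = p i ∧ p j ∧ H i j

    X-sym : ∀ i j → X i j ≡ X j i
    X-sym i j = begin
      p i ∧ p j ∧ H i j      ≡⟨ cong (λ z → p i ∧ p j ∧ z) (proj₁ simple i j) ⟩
      p i ∧ (p j ∧ H j i)    ≡⟨ sym (∧-assoc (p i) (p j) _) ⟩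
      (p i ∧ p j) ∧ H j i    ≡⟨ cong (_∧ H j i) (∧-comm (p i) (p j)) ⟩
      (p j ∧ p i) ∧ H j i    ≡⟨ ∧-assoc (p j) (p i) _ ⟩
      p j ∧ p i ∧ H j i      ∎

    X-irr : ∀ i → X i i ≡ false
    X-irr i rewrite proj₂ simple i = trans (cong (p i ∧_) (∧-zeroʳ (p i))) (∧-zeroʳ (p i))

    _<_ : Fin n → Fin n → Bool
    i < j = toℕ i <ᵇ toℕ j

    T⇒≡true : ∀ {b} → T b → b ≡ true
    T⇒≡true {true} _ = refl

    ¬T⇒≡false : ∀ {b} → ¬ T b → b ≡ false
    ¬T⇒≡false {true} n = ⊥-elim (n tt)
    ¬T⇒≡false {false} n = refl

    -- each pair is counted once, in the orientation with i < j
    orient : ∀ i j → count01 (X i j) ≡ count01 ((i < j) ∧ X i j) + count01 ((j < i) ∧ X j i)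
    orient i j with i ≟ j
    ... | yes refl rewrite X-irr i | ∧-zeroʳ (i < i) = refl
    ... | no ne with <-cmp (toℕ i) (toℕ j)
    ...   | tri< lt _ _ rewrite T⇒≡true (<⇒<ᵇ lt) | ¬T⇒≡false (λ t → <-asym lt (<ᵇ⇒< (toℕ j) (toℕ i) t)) =
      sym (+-identityʳ _)
    ...   | tri≈ _ eq _ = ⊥-elim (ne (toℕ-injective eq))
    ...   | tri> _ _ gt rewrite T⇒≡true (<⇒<ᵇ gt) | ¬T⇒≡false (λ t → <-asym gt (<ᵇ⇒< (toℕ i) (toℕ j) t)) | X-sym j i =
      refl

  arcs≡2*edges : arcs H p ≡ 2 * edges H p
  arcs≡2*edges = begin
    arcs H p
      ≡⟨ sum-cong-≗ (λ i → sum-cong-≗ (λ j → orient i j)) ⟩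
    sum (λ i → sum (λ j → count01 ((i < j) ∧ X i j) + count01 ((j < i) ∧ X j i)))
      ≡⟨ sum-cong-≗ (λ i → ∑-distrib-+ (λ j → count01 ((i < j) ∧ X i j)) (λ j → count01 ((j < i) ∧ X j i))) ⟩
    sum (λ i → sum (λ j → count01 ((i < j) ∧ X i j)) + sum (λ j → count01 ((j < i) ∧ X j i)))
      ≡⟨ ∑-distrib-+ (λ i → sum (λ j → count01 ((i < j) ∧ X i j))) (λ i → sum (λ j → count01 ((j < i) ∧ X j i))) ⟩
    e + sum (λ i → sum (λ j → count01 ((j < i) ∧ X j i)))
      ≡⟨ cong (e +_) (∑-comm (λ i j → count01 ((j < i) ∧ X j i))) ⟩
    e + e
      ≡⟨ cong (e +_) (sym (+-identityʳ e)) ⟩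
    2 * e ∎
    where e = edges H p

-- The collision as a gluing

==-refl : ∀ {n} (x : Fin n) → (x == x) ≡ true
==-refl x with x ≟ x
... | yes _ = refl
... | no n = ⊥-elim (n refl)

==-false : ∀ {n} {x y : Fin n} → x ≢ y → (x == y) ≡ false
==-false {x = x} {y} ne with x ≟ y
... | yes e = ⊥-elim (ne e)
... | no _ = refl

==-true : ∀ {n} {x y : Fin n} → (x == y) ≡ true → x ≡ y
==-true {x = x} {y} e with x ≟ y
... | yes p = p

simple-edge≢ : ∀ {n} {H : Graph n} → IsSimple H → ∀ {a b} → H a b ≡ true → a ≢ b
simple-edge≢ {H = H} (_ , irr) {a} e refl with () ← trans (sym e) (irr a)

module Collision {k m : ℕ} (G₁ : Graph (suc (suc k))) (G₂ : Graph (suc (suc m)))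
                 (a₁ b₁ : Fin (suc (suc k))) (a₂ b₂ : Fin (suc (suc m)))
                 (simple₁ : IsSimple G₁) (simple₂ : IsSimple G₂)
                 (a₁b₁ : G₁ a₁ b₁ ≡ true) (a₂b₂ : G₂ a₂ b₂ ≡ true) where
  n₁ : ℕ
  n₁ = suc (suc k)

  G : Graph (n₁ + m)
  G = collision G₁ G₂ a₁ b₁ a₂ b₂

  a₁≢b₁ : a₁ ≢ b₁
  a₁≢b₁ = simple-edge≢ simple₁ a₁b₁

  a₂≢b₂ : a₂ ≢ b₂
  a₂≢b₂ = simple-edge≢ simple₂ a₂b₂

  isE₁ : Fin n₁ → Fin n₁ → Bool
  isE₁ i j = ((i == a₁) ∧ (j == b₁)) ∨ ((i == b₁) ∧ (j == a₁))

  em : Fin m → Fin (suc (suc m))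
  em = emb a₂ b₂

  G-₁₁ : ∀ i j → G (i ↑ˡ m) (j ↑ˡ m) ≡ G₁ i j ∧ not (isE₁ i j)
  G-₁₁ i j rewrite splitAt-↑ˡ n₁ i m | splitAt-↑ˡ n₁ j m = refl

  G-₂₂ : ∀ l l' → G (n₁ ↑ʳ l) (n₁ ↑ʳ l') ≡ G₂ (em l) (em l')
  G-₂₂ l l' rewrite splitAt-↑ʳ n₁ m l | splitAt-↑ʳ n₁ m l' = refl

  G-sym₁₂ : ∀ i l → G (n₁ ↑ʳ l) (i ↑ˡ m) ≡ G (i ↑ˡ m) (n₁ ↑ʳ l)
  G-sym₁₂ i l rewrite splitAt-↑ˡ n₁ i m | splitAt-↑ʳ n₁ m l = refl

  G-a₂ : ∀ l → G (a₁ ↑ˡ m) (n₁ ↑ʳ l) ≡ G₂ a₂ (em l)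
  G-a₂ l rewrite splitAt-↑ˡ n₁ a₁ m | splitAt-↑ʳ n₁ m l | ==-refl a₁ = refl

  G-b₂ : ∀ l → G (b₁ ↑ˡ m) (n₁ ↑ʳ l) ≡ G₂ b₂ (em l)
  G-b₂ l rewrite splitAt-↑ˡ n₁ b₁ m | splitAt-↑ʳ n₁ m l | ==-false {x = b₁} {y = a₁} (λ e → a₁≢b₁ (sym e)) | ==-refl b₁ = refl

  G-inner₁₂ : ∀ i l → i ≢ a₁ → i ≢ b₁ → G (i ↑ˡ m) (n₁ ↑ʳ l) ≡ false
  G-inner₁₂ i l ia ib rewrite splitAt-↑ˡ n₁ i m | splitAt-↑ʳ n₁ m l | ==-false ia | ==-false ib = refl

  data Half : Fin (n₁ + m) → Set where
    left : ∀ i → Half (i ↑ˡ m)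
    right : ∀ l → Half (n₁ ↑ʳ l)

  half : ∀ x → Half x
  half x with splitAt n₁ x in eq
  ... | inj₁ i = subst Half (splitAt⁻¹-↑ˡ eq) (left i)
  ... | inj₂ l = subst Half (splitAt⁻¹-↑ʳ eq) (right l)

  ↑ˡ≢↑ʳ : ∀ i l → i ↑ˡ m ≢ n₁ ↑ʳ l
  ↑ˡ≢↑ʳ i l e with () ← trans (sym (splitAt-↑ˡ n₁ i m)) (trans (cong (splitAt n₁) e) (splitAt-↑ʳ n₁ m l))

  unemb : (y : Fin (suc (suc m))) → y ≢ a₂ → y ≢ b₂ → Fin m
  unemb y ya yb = punchOut {i = skipOut a₂ b₂} {j = y'} s≢y'
    where
    y' : Fin (suc m)
    y' = punchOut {i = a₂} {j = y} (λ e → ya (sym e))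
    s≢y' : skipOut a₂ b₂ ≢ y'
    s≢y' e = yb (trans (sym (punchIn-punchOut {i = a₂} {j = y} (λ e → ya (sym e))))
                       (trans (cong (punchIn a₂) (sym e)) (punchIn-skipOut a₂ b₂ a₂≢b₂)))

  em-unemb : ∀ y ya yb → em (unemb y ya yb) ≡ y
  em-unemb y ya yb = trans (cong (punchIn a₂) (punchIn-punchOut _)) (punchIn-punchOut _)

  data Vertex₂ : Fin (suc (suc m)) → Set where
    isA : Vertex₂ a₂
    isB : Vertex₂ b₂
    isInner : ∀ l → Vertex₂ (em l)

  vertex₂ : ∀ y → Vertex₂ y
  vertex₂ y with y ≟ a₂
  ... | yes refl = isA
  ... | no ya with y ≟ b₂
  ...   | yes refl = isB
  ...   | no yb = subst Vertex₂ (em-unemb y ya yb) (isInner (unemb y ya yb))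

  ι₂ : Fin (suc (suc m)) → Fin (n₁ + m)
  ι₂ y with y ≟ a₂
  ... | yes _ = a₁ ↑ˡ m
  ... | no ya with y ≟ b₂
  ...   | yes _ = b₁ ↑ˡ m
  ...   | no yb = n₁ ↑ʳ unemb y ya yb

  ι₂-a : ι₂ a₂ ≡ a₁ ↑ˡ m
  ι₂-a with a₂ ≟ a₂
  ... | yes _ = refl
  ... | no n = ⊥-elim (n refl)

  ι₂-b : ι₂ b₂ ≡ b₁ ↑ˡ m
  ι₂-b with b₂ ≟ a₂
  ... | yes e = ⊥-elim (a₂≢b₂ (sym e))
  ... | no _ with b₂ ≟ b₂
  ...   | yes _ = refl
  ...   | no n = ⊥-elim (n refl)

  ι₂-em : ∀ l → ι₂ (em l) ≡ n₁ ↑ʳ l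
  ι₂-em l with em l ≟ a₂
  ... | yes e = ⊥-elim (emb≢a a₂ b₂ l e)
  ... | no ya with em l ≟ b₂
  ...   | yes e = ⊥-elim (emb≢b a₂ b₂ a₂≢b₂ l e)
  ...   | no yb = cong (n₁ ↑ʳ_) (emb-injective a₂ b₂ (em-unemb (em l) ya yb))

  isE₁-sym : ∀ i j → isE₁ i j ≡ isE₁ j i
  isE₁-sym i j = trans (∨-comm ((i == a₁) ∧ (j == b₁)) ((i == b₁) ∧ (j == a₁)))
                       (cong₂ _∨_ (∧-comm (i == b₁) (j == a₁)) (∧-comm (i == a₁) (j == b₁)))

  isE₁-false : ∀ {x y} → ¬ (x ≡ a₁ × y ≡ b₁) → ¬ (x ≡ b₁ × y ≡ a₁) → isE₁ x y ≡ false
  isE₁-false {x} {y} ¬ab ¬ba = cong₂ _∨_ (conj ¬ab) (conj ¬ba)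
    where
    conj : ∀ {u v} {c d : Fin n₁} → ¬ (u ≡ c × v ≡ d) → (u == c) ∧ (v == d) ≡ false
    conj {u} {v} {c} {d} n with u == c in p | v == d in q
    ... | true | true = ⊥-elim (n (==-true p , ==-true q))
    ... | true | false = refl
    ... | false | _ = refl

  G-sym : ∀ x y → G x y ≡ G y x
  G-sym x y with half x | half y
  ... | left i | left j rewrite G-₁₁ i j | G-₁₁ j i | proj₁ simple₁ i j | isE₁-sym i j = refl
  ... | left i | right l = sym (G-sym₁₂ i l)
  ... | right l | left i = G-sym₁₂ i l
  ... | right l | right l' rewrite G-₂₂ l l' | G-₂₂ l' l = proj₁ simple₂ _ _

  G-irr : ∀ x → G x x ≡ false
  G-irr x with half x
  ... | left i rewrite G-₁₁ i i | proj₂ simple₁ i = refl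
  ... | right l rewrite G-₂₂ l l = proj₂ simple₂ _

  simple : IsSimple G
  simple = G-sym , G-irr

  Adj : Fin (n₁ + m) → Fin (n₁ + m) → Set
  Adj x y = G x y ≡ true

  ∧-true-left : ∀ {a b} → a ∧ b ≡ true → a ≡ true
  ∧-true-left {true} _ = refl

  false≢true : ∀ {b} → b ≡ false → b ≢ true
  false≢true refl ()

  Adj-reflect : ∀ {u v} → Adj u v →
                (Σ (Fin n₁) λ x → Σ (Fin n₁) λ y → x ↑ˡ m ≡ u × y ↑ˡ m ≡ v × G₁ x y ≡ true)
              ⊎ (Σ (Fin (suc (suc m))) λ x → Σ (Fin (suc (suc m))) λ y → ι₂ x ≡ u × ι₂ y ≡ v × G₂ x y ≡ true)
  Adj-reflect {u} {v} e with half u | half v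
  ... | left i | left j = inj₁ (i , j , refl , refl , ∧-true-left (trans (sym (G-₁₁ i j)) e))
  ... | right l | right l' = inj₂ (em l , em l' , ι₂-em l , ι₂-em l' , trans (sym (G-₂₂ l l')) e)
  ... | left i | right l with i ≟ a₁
  ...   | yes refl = inj₂ (a₂ , em l , ι₂-a , ι₂-em l , trans (sym (G-a₂ l)) e)
  ...   | no ia with i ≟ b₁
  ...     | yes refl = inj₂ (b₂ , em l , ι₂-b , ι₂-em l , trans (sym (G-b₂ l)) e)
  ...     | no ib = ⊥-elim (false≢true (G-inner₁₂ i l ia ib) e)
  Adj-reflect {u} {v} e | right l | left i with i ≟ a₁
  ...   | yes refl = inj₂ (em l , a₂ , ι₂-em l , ι₂-a ,
                           trans (proj₁ simple₂ _ _) (trans (sym (G-a₂ l)) (trans (sym (G-sym₁₂ a₁ l)) e)))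
  ...   | no ia with i ≟ b₁
  ...     | yes refl = inj₂ (em l , b₂ , ι₂-em l , ι₂-b ,
                           trans (proj₁ simple₂ _ _) (trans (sym (G-b₂ l)) (trans (sym (G-sym₁₂ b₁ l)) e)))
  ...     | no ib = ⊥-elim (false≢true (trans (G-sym₁₂ i l) (G-inner₁₂ i l ia ib)) e)

  Adj-embed₁ : ∀ {x y} → G₁ x y ≡ true → ¬ (x ≡ a₁ × y ≡ b₁) → ¬ (x ≡ b₁ × y ≡ a₁) → Adj (x ↑ˡ m) (y ↑ˡ m)
  Adj-embed₁ {x} {y} e ¬ab ¬ba rewrite G-₁₁ x y | e | isE₁-false ¬ab ¬ba = refl

  Adj-embed₂ : ∀ {x y} → G₂ x y ≡ true → ¬ (x ≡ a₂ × y ≡ b₂) → ¬ (x ≡ b₂ × y ≡ a₂) → Adj (ι₂ x) (ι₂ y)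
  Adj-embed₂ {x} {y} e ¬ab ¬ba with vertex₂ x | vertex₂ y
  ... | isA | isA = ⊥-elim (false≢true (proj₂ simple₂ a₂) e)
  ... | isA | isB = ⊥-elim (¬ab (refl , refl))
  ... | isB | isA = ⊥-elim (¬ba (refl , refl))
  ... | isB | isB = ⊥-elim (false≢true (proj₂ simple₂ b₂) e)
  ... | isA | isInner l rewrite ι₂-a | ι₂-em l = trans (G-a₂ l) e
  ... | isB | isInner l rewrite ι₂-b | ι₂-em l = trans (G-b₂ l) e
  ... | isInner l | isA rewrite ι₂-a | ι₂-em l = trans (G-sym₁₂ a₁ l) (trans (G-a₂ l) (trans (proj₁ simple₂ _ _) e))
  ... | isInner l | isB rewrite ι₂-b | ι₂-em l = trans (G-sym₁₂ b₁ l) (trans (G-b₂ l) (trans (proj₁ simple₂ _ _) e))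
  ... | isInner l | isInner l' rewrite ι₂-em l | ι₂-em l' = trans (G-₂₂ l l') e

  ι₂-injective : ∀ {x y} → ι₂ x ≡ ι₂ y → x ≡ y
  ι₂-injective {x} {y} e with vertex₂ x | vertex₂ y
  ... | isA | isA = refl
  ... | isB | isB = refl
  ... | isA | isB = ⊥-elim (a₁≢b₁ (↑ˡ-injective m _ _ (trans (sym ι₂-a) (trans e ι₂-b))))
  ... | isB | isA = ⊥-elim (a₁≢b₁ (↑ˡ-injective m _ _ (trans (sym ι₂-a) (trans (sym e) ι₂-b))))
  ... | isA | isInner l = ⊥-elim (↑ˡ≢↑ʳ a₁ l (trans (sym ι₂-a) (trans e (ι₂-em l))))
  ... | isB | isInner l = ⊥-elim (↑ˡ≢↑ʳ b₁ l (trans (sym ι₂-b) (trans e (ι₂-em l))))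
  ... | isInner l | isA = ⊥-elim (↑ˡ≢↑ʳ a₁ l (trans (sym ι₂-a) (trans (sym e) (ι₂-em l))))
  ... | isInner l | isB = ⊥-elim (↑ˡ≢↑ʳ b₁ l (trans (sym ι₂-b) (trans (sym e) (ι₂-em l))))
  ... | isInner l | isInner l' = cong em (↑ʳ-injective n₁ l l' (trans (sym (ι₂-em l)) (trans e (ι₂-em l'))))

  ι-meet : ∀ {x y} → x ↑ˡ m ≡ ι₂ y → (x ≡ a₁ × y ≡ a₂) ⊎ (x ≡ b₁ × y ≡ b₂)
  ι-meet {x} {y} e with vertex₂ y
  ... | isA = inj₁ (↑ˡ-injective m _ _ (trans e ι₂-a) , refl)
  ... | isB = inj₂ (↑ˡ-injective m _ _ (trans e ι₂-b) , refl)
  ... | isInner l = ⊥-elim (↑ˡ≢↑ʳ x l (trans e (ι₂-em l)))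

  ι-cover : ∀ v → (Σ (Fin n₁) λ x → x ↑ˡ m ≡ v) ⊎ (Σ (Fin (suc (suc m))) λ y → ι₂ y ≡ v)
  ι-cover v with half v
  ... | left i = inj₁ (i , refl)
  ... | right l = inj₂ (em l , ι₂-em l)

  gluing : Fin k → Fin m → Gluing
  gluing j₁ j₂ = record
    { V = Fin (n₁ + m) ; V₁ = Fin n₁ ; V₂ = Fin (suc (suc m))
    ; E = Adj ; E₁ = Edge G₁ ; E₂ = Edge G₂
    ; a₁ = a₁ ; b₁ = b₁ ; a₂ = a₂ ; b₂ = b₂ ; ι₁ = _↑ˡ m ; ι₂ = ι₂
    ; _≟V_ = _≟_ ; _≟₁_ = _≟_ ; _≟₂_ = _≟_
    ; ι₁-injective = ↑ˡ-injective m _ _ ; ι₂-injective = ι₂-injective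
    ; ι-a = sym ι₂-a ; ι-b = sym ι₂-b
    ; ι-meet = ι-meet ; ι-cover = ι-cover
    ; E-sym = λ {x} {y} e → trans (G-sym y x) e
    ; E₁-sym = λ {x} {y} e → trans (proj₁ simple₁ y x) e
    ; E₂-sym = λ {x} {y} e → trans (proj₁ simple₂ y x) e
    ; E-reflect = Adj-reflect ; E₁-embed = Adj-embed₁ ; E₂-embed = Adj-embed₂
    ; a₁b₁ = a₁b₁ ; a₂b₂ = a₂b₂ ; a₁≢b₁ = a₁≢b₁ ; a₂≢b₂ = a₂≢b₂
    ; c₁ = emb a₁ b₁ j₁ ; c₁≢a₁ = emb≢a a₁ b₁ j₁ ; c₁≢b₁ = emb≢b a₁ b₁ a₁≢b₁ j₁
    ; c₂ = em j₂ ; c₂≢a₂ = emb≢a a₂ b₂ j₂ ; c₂≢b₂ = emb≢b a₂ b₂ a₂≢b₂ j₂ }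

count-∧false : ∀ x y → count01 (x ∧ y ∧ false) ≡ 0
count-∧false true true = refl
count-∧false true false = refl
count-∧false false y = refl

count-∧true : ∀ x y → count01 (x ∧ y ∧ true) ≡ count01 (x ∧ y)
count-∧true x y = cong (λ z → count01 (x ∧ z)) (∧-identityʳ y)

∧-swapˡ : ∀ x y z → x ∧ y ∧ z ≡ y ∧ x ∧ z
∧-swapˡ true true z = refl
∧-swapˡ true false z = refl
∧-swapˡ false true z = refl
∧-swapˡ false false z = refl

count-split : ∀ x y g e → count01 (x ∧ y ∧ g) ≡ count01 (x ∧ y ∧ (g ∧ not e)) + count01 (x ∧ y ∧ (g ∧ e))
count-split false y g e = refl
count-split true false g e = refl
count-split true true false e = refl
count-split true true true true = refl
count-split true true true false = refl

-- Splitting arcs by the sides of their ends: the arcs inside side 1 are those of G₁ except e₁,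
-- the cross arcs are those of G₂ at a₂ and b₂. With ab = [a, b ∈ p], the arcs along e₁ and e₂
-- (2·ab each) are the only ones lost.
module Counting {k m : ℕ} (G₁ : Graph (suc (suc k))) (G₂ : Graph (suc (suc m)))
                (a₁ b₁ : Fin (suc (suc k))) (a₂ b₂ : Fin (suc (suc m)))
                (simple₁ : IsSimple G₁) (simple₂ : IsSimple G₂)
                (a₁b₁ : G₁ a₁ b₁ ≡ true) (a₂b₂ : G₂ a₂ b₂ ≡ true)
                (p : Fin (suc (suc k) + m) → Bool) where
  open Collision G₁ G₂ a₁ b₁ a₂ b₂ simple₁ simple₂ a₁b₁ a₂b₂

  p₁ : Fin n₁ → Bool
  p₁ i = p (i ↑ˡ m)
  p₂ : Fin (suc (suc m)) → Bool
  p₂ y = p (ι₂ y)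
  q : Fin m → Bool
  q l = p (n₁ ↑ʳ l)
  pa pb : Bool
  pa = p (a₁ ↑ˡ m)
  pb = p (b₁ ↑ˡ m)
  ab : ℕ
  ab = count01 (pa ∧ pb)

  arc : Fin (n₁ + m) → Fin (n₁ + m) → ℕ
  arc x y = count01 (p x ∧ p y ∧ G x y)

  nbrᵃ nbrᵇ innerRow : Fin m → ℕ
  nbrᵃ l = count01 (pa ∧ q l ∧ G₂ a₂ (em l))
  nbrᵇ l = count01 (pb ∧ q l ∧ G₂ b₂ (em l))
  innerRow l = sum (λ l' → count01 (q l ∧ q l' ∧ G₂ (em l) (em l')))

  W₁₁ W₁₂ W₂₁ W₂₂ Nᵃ Nᵇ : ℕ
  W₁₁ = sum λ i → sum λ j → count01 (p₁ i ∧ p₁ j ∧ (G₁ i j ∧ not (isE₁ i j)))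
  W₁₂ = sum λ i → sum λ l → arc (i ↑ˡ m) (n₁ ↑ʳ l)
  W₂₁ = sum λ l → sum λ j → arc (n₁ ↑ʳ l) (j ↑ˡ m)
  W₂₂ = sum innerRow
  Nᵃ = sum nbrᵃ
  Nᵇ = sum nbrᵇ

  arcs-blocks : arcs G p ≡ (W₁₁ + W₁₂) + (W₂₁ + W₂₂)
  arcs-blocks = begin
    sum (λ x → sum (arc x))
      ≡⟨ sum-↑ n₁ m (λ x → sum (arc x)) ⟩
    sum (λ i → sum (arc (i ↑ˡ m))) + sum (λ l → sum (arc (n₁ ↑ʳ l)))
      ≡⟨ cong₂ _+_ (sum-cong-≗ (λ i → sum-↑ n₁ m (arc (i ↑ˡ m)))) (sum-cong-≗ (λ l → sum-↑ n₁ m (arc (n₁ ↑ʳ l)))) ⟩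
    sum (λ i → sum (λ j → arc (i ↑ˡ m) (j ↑ˡ m)) + sum (λ l → arc (i ↑ˡ m) (n₁ ↑ʳ l)))
      + sum (λ l → sum (λ j → arc (n₁ ↑ʳ l) (j ↑ˡ m)) + sum (λ l' → arc (n₁ ↑ʳ l) (n₁ ↑ʳ l')))
      ≡⟨ cong₂ _+_ (∑-distrib-+ (λ i → sum (λ j → arc (i ↑ˡ m) (j ↑ˡ m))) (λ i → sum (λ l → arc (i ↑ˡ m) (n₁ ↑ʳ l))))
                   (∑-distrib-+ (λ l → sum (λ j → arc (n₁ ↑ʳ l) (j ↑ˡ m))) (λ l → sum (λ l' → arc (n₁ ↑ʳ l) (n₁ ↑ʳ l')))) ⟩
    (sum (λ i → sum (λ j → arc (i ↑ˡ m) (j ↑ˡ m))) + W₁₂) + (W₂₁ + sum (λ l → sum (λ l' → arc (n₁ ↑ʳ l) (n₁ ↑ʳ l'))))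
      ≡⟨ cong₂ (λ u v → (u + W₁₂) + (W₂₁ + v))
           (sum-cong-≗ (λ i → sum-cong-≗ (λ j → cong (λ z → count01 (p₁ i ∧ p₁ j ∧ z)) (G-₁₁ i j))))
           (sum-cong-≗ (λ l → sum-cong-≗ (λ l' → cong (λ z → count01 (q l ∧ q l' ∧ z)) (G-₂₂ l l')))) ⟩
    (W₁₁ + W₁₂) + (W₂₁ + W₂₂) ∎

  W₁₂≡N : W₁₂ ≡ Nᵃ + Nᵇ
  W₁₂≡N = begin
    W₁₂ ≡⟨ sum-support₂ a₁ b₁ a₁≢b₁ (λ i → sum λ l → arc (i ↑ˡ m) (n₁ ↑ʳ l))
             (λ i ia ib → sum-zero _ (λ l → trans (cong (λ z → count01 (p₁ i ∧ q l ∧ z)) (G-inner₁₂ i l ia ib))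
                                                  (count-∧false (p₁ i) (q l)))) ⟩
    sum (λ l → arc (a₁ ↑ˡ m) (n₁ ↑ʳ l)) + sum (λ l → arc (b₁ ↑ˡ m) (n₁ ↑ʳ l))
      ≡⟨ cong₂ _+_ (sum-cong-≗ (λ l → cong (λ z → count01 (pa ∧ q l ∧ z)) (G-a₂ l)))
                   (sum-cong-≗ (λ l → cong (λ z → count01 (pb ∧ q l ∧ z)) (G-b₂ l))) ⟩
    Nᵃ + Nᵇ ∎

  W₂₁-row : ∀ l → sum (λ j → arc (n₁ ↑ʳ l) (j ↑ˡ m)) ≡ nbrᵃ l + nbrᵇ l
  W₂₁-row l = begin
    sum (λ j → arc (n₁ ↑ʳ l) (j ↑ˡ m))
      ≡⟨ sum-support₂ a₁ b₁ a₁≢b₁ (λ j → arc (n₁ ↑ʳ l) (j ↑ˡ m))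
           (λ j ja jb → trans (cong (λ z → count01 (q l ∧ p₁ j ∧ z)) (trans (G-sym₁₂ j l) (G-inner₁₂ j l ja jb)))
                              (count-∧false (q l) (p₁ j))) ⟩
    count01 (q l ∧ pa ∧ G (n₁ ↑ʳ l) (a₁ ↑ˡ m)) + count01 (q l ∧ pb ∧ G (n₁ ↑ʳ l) (b₁ ↑ˡ m))
      ≡⟨ cong₂ _+_ (cong count01 (trans (cong (λ z → q l ∧ pa ∧ z) (trans (G-sym₁₂ a₁ l) (G-a₂ l))) (∧-swapˡ (q l) pa _)))
                   (cong count01 (trans (cong (λ z → q l ∧ pb ∧ z) (trans (G-sym₁₂ b₁ l) (G-b₂ l))) (∧-swapˡ (q l) pb _))) ⟩
    nbrᵃ l + nbrᵇ l ∎

  W₂₁≡N : W₂₁ ≡ Nᵃ + Nᵇ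
  W₂₁≡N = trans (sum-cong-≗ W₂₁-row) (∑-distrib-+ nbrᵃ nbrᵇ)

  isE₁-ab : isE₁ a₁ b₁ ≡ true
  isE₁-ab rewrite ==-refl a₁ | ==-refl b₁ = refl

  isE₁-ba : isE₁ b₁ a₁ ≡ true
  isE₁-ba rewrite ==-refl a₁ | ==-refl b₁ | ==-false {x = b₁} {y = a₁} (λ e → a₁≢b₁ (sym e)) = refl

  e₁-arc : Fin n₁ → Fin n₁ → ℕ
  e₁-arc i j = count01 (p₁ i ∧ p₁ j ∧ (G₁ i j ∧ isE₁ i j))

  e₁-arc-zero : ∀ i j → isE₁ i j ≡ false → e₁-arc i j ≡ 0
  e₁-arc-zero i j e rewrite e | ∧-zeroʳ (G₁ i j) = count-∧false (p₁ i) (p₁ j)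

  e₁-arcs : sum (λ i → sum (e₁-arc i)) ≡ ab + ab
  e₁-arcs = begin
    sum (λ i → sum (e₁-arc i))
      ≡⟨ sum-support₂ a₁ b₁ a₁≢b₁ (λ i → sum (e₁-arc i))
           (λ i ia ib → sum-zero _ (λ j → e₁-arc-zero i j (isE₁-false (λ { (x , _) → ia x }) (λ { (x , _) → ib x })))) ⟩
    sum (e₁-arc a₁) + sum (e₁-arc b₁)
      ≡⟨ cong₂ _+_ (sum-support₁ b₁ (e₁-arc a₁) (λ j jb → e₁-arc-zero a₁ j
                      (isE₁-false (λ { (_ , x) → jb x }) (λ { (x , _) → a₁≢b₁ x }))))
                   (sum-support₁ a₁ (e₁-arc b₁) (λ j ja → e₁-arc-zero b₁ j
                      (isE₁-false (λ { (x , _) → a₁≢b₁ (sym x) }) (λ { (_ , x) → ja x })))) ⟩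
    e₁-arc a₁ b₁ + e₁-arc b₁ a₁
      ≡⟨ cong₂ _+_ (trans (cong (λ z → count01 (pa ∧ pb ∧ z)) (trans (cong₂ _∧_ a₁b₁ isE₁-ab) refl)) (count-∧true pa pb))
                   (trans (cong (λ z → count01 (pb ∧ pa ∧ z)) (cong₂ _∧_ (trans (proj₁ simple₁ b₁ a₁) a₁b₁) isE₁-ba))
                          (trans (count-∧true pb pa) (cong count01 (∧-comm pb pa)))) ⟩
    ab + ab ∎

  arcs₁-split : arcs G₁ p₁ ≡ W₁₁ + 2 * ab
  arcs₁-split = begin
    arcs G₁ p₁
      ≡⟨ sum-cong-≗ (λ i → sum-cong-≗ (λ j → count-split (p₁ i) (p₁ j) (G₁ i j) (isE₁ i j))) ⟩
    sum (λ i → sum (λ j → count01 (p₁ i ∧ p₁ j ∧ (G₁ i j ∧ not (isE₁ i j))) + e₁-arc i j))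
      ≡⟨ sum-cong-≗ (λ i → ∑-distrib-+ (λ j → count01 (p₁ i ∧ p₁ j ∧ (G₁ i j ∧ not (isE₁ i j)))) (e₁-arc i)) ⟩
    sum (λ i → sum (λ j → count01 (p₁ i ∧ p₁ j ∧ (G₁ i j ∧ not (isE₁ i j)))) + sum (e₁-arc i))
      ≡⟨ ∑-distrib-+ (λ i → sum (λ j → count01 (p₁ i ∧ p₁ j ∧ (G₁ i j ∧ not (isE₁ i j))))) (λ i → sum (e₁-arc i)) ⟩
    W₁₁ + sum (λ i → sum (e₁-arc i))
      ≡⟨ cong (W₁₁ +_) (trans e₁-arcs (cong (ab +_) (sym (+-identityʳ ab)))) ⟩
    W₁₁ + 2 * ab ∎

  p₂-a : p₂ a₂ ≡ pa
  p₂-a = cong p (ι₂-a)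
  p₂-b : p₂ b₂ ≡ pb
  p₂-b = cong p (ι₂-b)
  p₂-em : ∀ l → p₂ (em l) ≡ q l
  p₂-em l = cong p (ι₂-em l)

  rowSplit : Bool → Fin (suc (suc m)) → ℕ
  rowSplit P x = count01 (P ∧ pa ∧ G₂ x a₂) + count01 (P ∧ pb ∧ G₂ x b₂) + sum (λ l → count01 (P ∧ q l ∧ G₂ x (em l)))

  row₂ : Fin (suc (suc m)) → ℕ
  row₂ x = sum (λ y → count01 (p₂ x ∧ p₂ y ∧ G₂ x y))

  row₂-split : ∀ x → row₂ x ≡ rowSplit (p₂ x) x
  row₂-split x = trans (sum-emb a₂ b₂ a₂≢b₂ (λ y → count01 (p₂ x ∧ p₂ y ∧ G₂ x y)))
    (cong₂ _+_ (cong₂ _+_ (cong (λ z → count01 (p₂ x ∧ z ∧ G₂ x a₂)) p₂-a) (cong (λ z → count01 (p₂ x ∧ z ∧ G₂ x b₂)) p₂-b))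
               (sum-cong-≗ (λ l → cong (λ z → count01 (p₂ x ∧ z ∧ G₂ x (em l))) (p₂-em l))))

  rowSplit-a : rowSplit pa a₂ ≡ 0 + ab + Nᵃ
  rowSplit-a = cong₂ (λ u v → u + v + Nᵃ) (trans (cong (λ z → count01 (pa ∧ pa ∧ z)) (proj₂ simple₂ a₂)) (count-∧false pa pa))
                                    (trans (cong (λ z → count01 (pa ∧ pb ∧ z)) a₂b₂) (count-∧true pa pb))

  rowSplit-b : rowSplit pb b₂ ≡ ab + 0 + Nᵇ
  rowSplit-b = cong₂ (λ u v → u + v + Nᵇ) (trans (cong (λ z → count01 (pb ∧ pa ∧ z)) (trans (proj₁ simple₂ b₂ a₂) a₂b₂))
                                           (trans (count-∧true pb pa) (cong count01 (∧-comm pb pa))))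
                                    (trans (cong (λ z → count01 (pb ∧ pb ∧ z)) (proj₂ simple₂ b₂)) (count-∧false pb pb))

  rowSplit-inner : ∀ l → rowSplit (q l) (em l) ≡ nbrᵃ l + nbrᵇ l + innerRow l
  rowSplit-inner l = cong₂ (λ u v → u + v + innerRow l)
    (cong count01 (trans (cong (λ z → q l ∧ pa ∧ z) (proj₁ simple₂ (em l) a₂)) (∧-swapˡ (q l) pa _)))
    (cong count01 (trans (cong (λ z → q l ∧ pb ∧ z) (proj₁ simple₂ (em l) b₂)) (∧-swapˡ (q l) pb _)))

  arcs₂-split : arcs G₂ p₂ ≡ (0 + ab + Nᵃ) + (ab + 0 + Nᵇ) + (Nᵃ + Nᵇ + W₂₂)
  arcs₂-split = begin
    arcs G₂ p₂ ≡⟨ sum-emb a₂ b₂ a₂≢b₂ row₂ ⟩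
    row₂ a₂ + row₂ b₂ + sum (λ l → row₂ (em l))
      ≡⟨ cong₂ _+_ (cong₂ _+_ (trans (row₂-split a₂) (trans (cong (λ z → rowSplit z a₂) p₂-a) rowSplit-a))
                               (trans (row₂-split b₂) (trans (cong (λ z → rowSplit z b₂) p₂-b) rowSplit-b)))
                   (sum-cong-≗ (λ l → trans (row₂-split (em l)) (trans (cong (λ z → rowSplit z (em l)) (p₂-em l)) (rowSplit-inner l)))) ⟩
    (0 + ab + Nᵃ) + (ab + 0 + Nᵇ) + sum (λ l → nbrᵃ l + nbrᵇ l + innerRow l)
      ≡⟨ cong ((0 + ab + Nᵃ) + (ab + 0 + Nᵇ) +_)
           (trans (∑-distrib-+ (λ l → nbrᵃ l + nbrᵇ l) innerRow) (cong (_+ W₂₂) (∑-distrib-+ nbrᵃ nbrᵇ))) ⟩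
    (0 + ab + Nᵃ) + (ab + 0 + Nᵇ) + (Nᵃ + Nᵇ + W₂₂) ∎

  arcs-collision : arcs G p + 4 * ab ≡ arcs G₁ p₁ + arcs G₂ p₂
  arcs-collision = begin
    arcs G p + 4 * ab ≡⟨ cong (_+ 4 * ab) arcs-blocks ⟩
    ((W₁₁ + W₁₂) + (W₂₁ + W₂₂)) + 4 * ab ≡⟨ cong₂ (λ u v → ((W₁₁ + u) + (v + W₂₂)) + 4 * ab) W₁₂≡N W₂₁≡N ⟩
    ((W₁₁ + (Nᵃ + Nᵇ)) + ((Nᵃ + Nᵇ) + W₂₂)) + 4 * ab ≡⟨ cong (λ z → (z + ((Nᵃ + Nᵇ) + W₂₂)) + 4 * ab) (sym (+-assoc W₁₁ Nᵃ Nᵇ)) ⟩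
    ((W₁₁ + Nᵃ + Nᵇ) + ((Nᵃ + Nᵇ) + W₂₂)) + 4 * ab ≡⟨ arith W₁₁ W₂₂ Nᵃ Nᵇ ab ⟩
    (W₁₁ + 2 * ab) + ((0 + ab + Nᵃ) + (ab + 0 + Nᵇ) + (Nᵃ + Nᵇ + W₂₂)) ≡⟨ cong₂ _+_ (sym arcs₁-split) (sym arcs₂-split) ⟩
    arcs G₁ p₁ + arcs G₂ p₂ ∎
    where
    arith : ∀ w₁₁ w₂₂ na nb c → ((w₁₁ + na + nb) + ((na + nb) + w₂₂)) + 4 * c
                              ≡ (w₁₁ + 2 * c) + ((0 + c + na) + (c + 0 + nb) + (na + nb + w₂₂))
    arith = solve-∀

  vertices-collision : vertices p + count01 pa + count01 pb ≡ vertices p₁ + vertices p₂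
  vertices-collision = begin
    vertices p + count01 pa + count01 pb
      ≡⟨ cong (λ z → z + count01 pa + count01 pb) (sum-↑ n₁ m (λ x → count01 (p x))) ⟩
    (vertices p₁ + sum (λ l → count01 (q l))) + count01 pa + count01 pb
      ≡⟨ rearrange (vertices p₁) _ _ _ ⟩
    vertices p₁ + (count01 pa + count01 pb + sum (λ l → count01 (q l)))
      ≡⟨ cong (vertices p₁ +_) (sym (trans (sum-emb a₂ b₂ a₂≢b₂ (λ y → count01 (p₂ y)))
            (cong₂ _+_ (cong₂ _+_ (cong count01 p₂-a) (cong count01 p₂-b)) (sum-cong-≗ (λ l → cong count01 (p₂-em l)))))) ⟩
    vertices p₁ + vertices p₂ ∎
    where
    rearrange : ∀ v₁ r ca cb → (v₁ + r) + ca + cb ≡ v₁ + (ca + cb + r)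
    rearrange = solve-∀

  edges-collision : edges G p + 2 * ab ≡ edges G₁ p₁ + edges G₂ p₂
  edges-collision = *-cancelˡ-≡ _ _ 2 (begin
    2 * (edges G p + 2 * ab)                 ≡⟨ double-l (edges G p) ab ⟩
    2 * edges G p + 4 * ab                   ≡⟨ cong (_+ 4 * ab) (sym (arcs≡2*edges G simple p)) ⟩
    arcs G p + 4 * ab                        ≡⟨ arcs-collision ⟩
    arcs G₁ p₁ + arcs G₂ p₂                  ≡⟨ cong₂ _+_ (arcs≡2*edges G₁ simple₁ p₁) (arcs≡2*edges G₂ simple₂ p₂) ⟩
    2 * edges G₁ p₁ + 2 * edges G₂ p₂        ≡⟨ sym (*-distribˡ-+ 2 (edges G₁ p₁) _) ⟩
    2 * (edges G₁ p₁ + edges G₂ p₂)          ∎)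
    where
    double-l : ∀ e c → 2 * (e + 2 * c) ≡ 2 * e + 4 * c
    double-l = solve-∀

-- Edge counts of flats

edges-cong : ∀ {n} (H : Graph n) {p p' : Fin n → Bool} → (∀ i → p i ≡ p' i) → edges H p ≡ edges H p'
edges-cong H e = sum-cong-≗ (λ i → sum-cong-≗ (λ j →
  cong₂ (λ u v → count01 ((toℕ i <ᵇ toℕ j) ∧ u ∧ v ∧ H i j)) (e i) (e j)))

vertices-cong : ∀ {n} {p p' : Fin n → Bool} → (∀ i → p i ≡ p' i) → vertices p ≡ vertices p'
vertices-cong e = sum-cong-≗ (λ i → cong count01 (e i))

∈-tabulate : ∀ {n} (p : Fin n → Bool) {x} → x ∈ tabulate p ⇔ p x ≡ true
∈-tabulate p {x} = mk⇔ (λ x∈ → trans (sym (lookup∘tabulate p x)) ([]=⇒lookup x∈))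
                       (λ px → lookup⇒[]= x (tabulate p) (trans (lookup∘tabulate p x) px))

edges-flat : ∀ {n} {H : Graph n} → Spade2 H → (p : Fin n → Bool) {P : Fin n → Set} →
             (∀ {x} → P x ⇔ p x ≡ true) → IsGoodFlat (Edge H) P → edges H p ≡ 2 * vertices p ∸ 3
edges-flat {H = H} (_ , _ , _ , spade) p {P} P⇔p flat = begin
  edges H p                    ≡⟨ edges-cong H (λ i → sym (lookup∘tabulate p i)) ⟩
  edges H (lookup S)           ≡⟨ sym (edgesIn≡edges H S) ⟩
  edgesIn H S                  ≡⟨ spade S (IsGoodFlat⇒GoodFlat H S P⇔S flat) ⟩
  2 * ∣ S ∣ ∸ 3                ≡⟨ cong (λ z → 2 * z ∸ 3) (trans (∣∣≡vertices S) (vertices-cong (lookup∘tabulate p))) ⟩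
  2 * vertices p ∸ 3           ∎
  where
  S = tabulate p
  P⇔S : ∀ {x} → P x ⇔ x ∈ S
  P⇔S {x} = mk⇔ (λ px → Equivalence.from (∈-tabulate p) (Equivalence.to P⇔p px))
                (λ x∈ → Equivalence.from P⇔p (Equivalence.to (∈-tabulate p) x∈))

edges-all : ∀ {n} {H : Graph (suc n)} → Spade2 H → {p : Fin (suc n) → Bool} → (∀ i → p i ≡ true) →
            edges H p ≡ 2 * n
edges-all {H = H} (_ , _ , numEdges≡ , _) all =
  trans (edges-cong H all) (trans (sym (numEdges≡edges H)) numEdges≡)

vertices-all : ∀ {n} {p : Fin n → Bool} → (∀ i → p i ≡ true) → vertices p ≡ n
vertices-all {n} all = trans (vertices-cong all) (sum-one n)

double≡0 : ∀ x → 2 * x ≡ 0 → x ≡ 0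
double≡0 zero _ = refl

module _ {n} (H : Graph n) (p : Fin n → Bool) (a b : Fin n) (in-ends : ∀ y → p y ≡ true → y ≡ a ⊎ y ≡ b) where

  arcs-ends : IsSimple H → ¬ (p a ≡ true × p b ≡ true) → arcs H p ≡ 0
  arcs-ends (_ , irr) ¬ab = sum-zero _ (λ i → sum-zero _ (λ j → arc-zero i j))
    where
    loop : ∀ i → count01 (true ∧ true ∧ H i i) ≡ 0
    loop i rewrite irr i = refl
    arc-zero : ∀ i j → count01 (p i ∧ p j ∧ H i j) ≡ 0
    arc-zero i j with p i in ei | p j in ej
    ... | false | _ = refl
    ... | true | false = refl
    ... | true | true with in-ends i ei | in-ends j ej
    ...   | inj₁ refl | inj₁ refl = loop a
    ...   | inj₂ refl | inj₂ refl = loop b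
    ...   | inj₁ refl | inj₂ refl = ⊥-elim (¬ab (ei , ej))
    ...   | inj₂ refl | inj₁ refl = ⊥-elim (¬ab (ej , ei))

  edges-ends : IsSimple H → ¬ (p a ≡ true × p b ≡ true) → edges H p ≡ 0
  edges-ends simple ¬ab = double≡0 _ (trans (sym (arcs≡2*edges H simple p)) (arcs-ends simple ¬ab))

  vertices-ends : a ≢ b → vertices p ≡ count01 (p a) + count01 (p b)
  vertices-ends a≢b = sum-support₂ a b a≢b (λ i → count01 (p i)) outside
    where
    outside : ∀ i → i ≢ a → i ≢ b → count01 (p i) ≡ 0
    outside i ia ib with p i in ei
    ... | false = refl
    ... | true with in-ends i ei
    ...   | inj₁ e = ⊥-elim (ia e)
    ...   | inj₂ e = ⊥-elim (ib e)

sum-inner : ∀ {n} → (Fin (suc (suc n)) → Bool) → Fin (suc (suc n)) → Fin (suc (suc n)) → ℕ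
sum-inner q a b = sum (λ j → count01 (q (emb a b j)))

vertices-both-ends : ∀ {n} (q : Fin (suc (suc n)) → Bool) a b → a ≢ b → q a ≡ true → q b ≡ true →
                     vertices q ≡ suc (suc (sum-inner q a b))
vertices-both-ends q a b a≢b qa qb rewrite sum-emb a b a≢b (λ y → count01 (q y)) | qa | qb = refl

2*-∸3 : ∀ r → 2 * suc (suc r) ∸ 3 ≡ suc (2 * r)
2*-∸3 r rewrite +-suc r (suc (r + 0)) | +-suc r (r + 0) = refl

-- All of G₁ (t + 2 vertices, 2t + 2 edges) glued to a flat of G₂ (r + 2 vertices, 2r + 1 edges),
-- sharing two vertices and one edge, which the collision removes.
glued-count : ∀ e v t r → e + 2 ≡ 2 * suc t + (2 * suc (suc r) ∸ 3) → v + 2 ≡ suc (suc t) + suc (suc r) →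
              e ≡ 2 * v ∸ 3
glued-count e v t r he hv rewrite 2*-∸3 r = subst₂ (λ x y → x ≡ 2 * y ∸ 3) (sym e≡) (sym v≡) (sym (2*-∸3 (t + r)))
  where
  v≡ : v ≡ suc (suc (t + r))
  v≡ = +-cancelʳ-≡ 2 v _ (trans hv (arith t r))
    where arith : ∀ t r → suc (suc t) + suc (suc r) ≡ suc (suc (t + r)) + 2
          arith = solve-∀
  e≡ : e ≡ suc (2 * (t + r))
  e≡ = +-cancelʳ-≡ 2 e _ (trans he (arith t r))
    where arith : ∀ t r → 2 * suc t + suc (2 * r) ≡ suc (2 * (t + r)) + 2
          arith = solve-∀

module CollisionSpade2 {k m : ℕ} (G₁ : Graph (suc (suc k))) (G₂ : Graph (suc (suc m)))
            (a₁ b₁ : Fin (suc (suc k))) (a₂ b₂ : Fin (suc (suc m)))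
            (spade₁ : Spade2 G₁) (spade₂ : Spade2 G₂)
            (a₁b₁ : G₁ a₁ b₁ ≡ true) (a₂b₂ : G₂ a₂ b₂ ≡ true) (j₁ : Fin k) (j₂ : Fin m) where
  open Collision G₁ G₂ a₁ b₁ a₂ b₂ (proj₁ spade₁) (proj₁ spade₂) a₁b₁ a₂b₂
  module C = Counting G₁ G₂ a₁ b₁ a₂ b₂ (proj₁ spade₁) (proj₁ spade₂) a₁b₁ a₂b₂
  open Classification (gluing j₁ j₂)

  numEdges-collision : numEdges G ≡ 2 * ((suc (suc k) + m) ∸ 1)
  numEdges-collision = +-cancelʳ-≡ 2 _ _ (begin
    numEdges G + 2                          ≡⟨ cong (_+ 2) (numEdges≡edges G) ⟩
    edges G all + 2 * 1                     ≡⟨ C.edges-collision all ⟩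
    edges G₁ (C.p₁ all) + edges G₂ (C.p₂ all) ≡⟨ cong₂ _+_ (edges-all spade₁ (λ _ → refl)) (edges-all spade₂ (λ _ → refl)) ⟩
    2 * suc k + 2 * suc m                   ≡⟨ arith k m ⟩
    2 * (suc k + m) + 2                     ∎)
    where
    all : Fin (suc (suc k) + m) → Bool
    all _ = true
    arith : ∀ k m → 2 * suc k + 2 * suc m ≡ 2 * (suc k + m) + 2
    arith = solve-∀

  module GoodFlatCount (S : Subset (suc (suc k) + m)) (flat : GoodFlat G S) where
    p : Fin (suc (suc k) + m) → Bool
    p = lookup S

    e v e₁ e₂ v₁ v₂ : ℕ
    e = edges G p
    v = vertices p
    e₁ = edges G₁ (C.p₁ p)
    e₂ = edges G₂ (C.p₂ p)
    v₁ = vertices (C.p₁ p)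
    v₂ = vertices (C.p₂ p)

    ∈⇔ : ∀ {x} → x ∈ S ⇔ p x ≡ true
    ∈⇔ {x} = mk⇔ []=⇒lookup (lookup⇒[]= x S)

    ab≡0 : ¬ ((a₁ ↑ˡ m) ∈ S × (b₁ ↑ˡ m) ∈ S) → C.ab p ≡ 0
    ab≡0 ¬ab with p (a₁ ↑ˡ m) in ea | p (b₁ ↑ˡ m) in eb
    ... | true | true = ⊥-elim (¬ab (lookup⇒[]= _ S ea , lookup⇒[]= _ S eb))
    ... | true | false = refl
    ... | false | _ = refl

    flat-inside₁ : ¬ ((a₁ ↑ˡ m) ∈ S × (b₁ ↑ˡ m) ∈ S) → (∀ y → ι₂ y ∈ S → y ≡ a₂ ⊎ y ≡ b₂) →
                   IsGoodFlat (Edge G₁) (λ x → (x ↑ˡ m) ∈ S) → e ≡ 2 * v ∸ 3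
    flat-inside₁ ¬ab in-ends flat₁ = subst₂ (λ x y → x ≡ 2 * y ∸ 3) (sym e≡e₁) (sym v≡v₁) (edges-flat spade₁ (C.p₁ p) ∈⇔ flat₁)
      where
      in-ends₂ : ∀ y → C.p₂ p y ≡ true → y ≡ a₂ ⊎ y ≡ b₂
      in-ends₂ y py = in-ends y (lookup⇒[]= _ S py)
      e≡e₁ : e ≡ e₁
      e≡e₁ = begin
        e                     ≡⟨ sym (+-identityʳ e) ⟩
        e + 2 * 0             ≡⟨ cong (λ z → e + 2 * z) (sym (ab≡0 ¬ab)) ⟩
        e + 2 * C.ab p        ≡⟨ C.edges-collision p ⟩
        e₁ + e₂               ≡⟨ cong (e₁ +_) (edges-ends G₂ (C.p₂ p) a₂ b₂ in-ends₂ (proj₁ spade₂)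
                                  (λ (pa , pb) → ¬ab (lookup⇒[]= _ S (trans (sym (C.p₂-a p)) pa) ,
                                                      lookup⇒[]= _ S (trans (sym (C.p₂-b p)) pb)))) ⟩
        e₁ + 0                ≡⟨ +-identityʳ e₁ ⟩
        e₁                    ∎
      v≡v₁ : v ≡ v₁
      v≡v₁ = +-cancelʳ-≡ _ v v₁ (begin
        v + (count01 (C.pa p) + count01 (C.pb p))  ≡⟨ sym (+-assoc v _ _) ⟩
        v + count01 (C.pa p) + count01 (C.pb p)    ≡⟨ C.vertices-collision p ⟩
        v₁ + v₂                                   ≡⟨ cong (v₁ +_) (vertices-ends G₂ (C.p₂ p) a₂ b₂ in-ends₂ a₂≢b₂) ⟩
        v₁ + (count01 (C.p₂ p a₂) + count01 (C.p₂ p b₂))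
          ≡⟨ cong₂ (λ x y → v₁ + (count01 x + count01 y)) (C.p₂-a p) (C.p₂-b p) ⟩
        v₁ + (count01 (C.pa p) + count01 (C.pb p)) ∎)

    flat-inside₂ : ¬ ((a₁ ↑ˡ m) ∈ S × (b₁ ↑ˡ m) ∈ S) → (∀ x → (x ↑ˡ m) ∈ S → x ≡ a₁ ⊎ x ≡ b₁) →
                   IsGoodFlat (Edge G₂) (λ y → ι₂ y ∈ S) → e ≡ 2 * v ∸ 3
    flat-inside₂ ¬ab in-ends flat₂ = subst₂ (λ x y → x ≡ 2 * y ∸ 3) (sym e≡e₂) (sym v≡v₂) (edges-flat spade₂ (C.p₂ p) ∈⇔ flat₂)
      where
      in-ends₁ : ∀ x → C.p₁ p x ≡ true → x ≡ a₁ ⊎ x ≡ b₁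
      in-ends₁ x px = in-ends x (lookup⇒[]= _ S px)
      e≡e₂ : e ≡ e₂
      e≡e₂ = begin
        e                     ≡⟨ sym (+-identityʳ e) ⟩
        e + 2 * 0             ≡⟨ cong (λ z → e + 2 * z) (sym (ab≡0 ¬ab)) ⟩
        e + 2 * C.ab p        ≡⟨ C.edges-collision p ⟩
        e₁ + e₂               ≡⟨ cong (_+ e₂) (edges-ends G₁ (C.p₁ p) a₁ b₁ in-ends₁ (proj₁ spade₁)
                                  (λ (pa , pb) → ¬ab (lookup⇒[]= _ S pa , lookup⇒[]= _ S pb))) ⟩
        0 + e₂                ∎
      v≡v₂ : v ≡ v₂
      v≡v₂ = +-cancelʳ-≡ _ v v₂ (begin
        v + (count01 (C.pa p) + count01 (C.pb p))  ≡⟨ sym (+-assoc v _ _) ⟩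
        v + count01 (C.pa p) + count01 (C.pb p)    ≡⟨ C.vertices-collision p ⟩
        v₁ + v₂                                   ≡⟨ cong (_+ v₂) (vertices-ends G₁ (C.p₁ p) a₁ b₁ in-ends₁ a₁≢b₁) ⟩
        (count01 (C.pa p) + count01 (C.pb p)) + v₂ ≡⟨ +-comm _ v₂ ⟩
        v₂ + (count01 (C.pa p) + count01 (C.pb p)) ∎)

    both-ends : (a₁ ↑ˡ m) ∈ S → (b₁ ↑ˡ m) ∈ S → C.ab p ≡ 1 × count01 (C.pa p) ≡ 1 × count01 (C.pb p) ≡ 1
    both-ends a∈ b∈ rewrite []=⇒lookup a∈ | []=⇒lookup b∈ = refl , refl , refl

    flat-over₁ : (∀ x → (x ↑ˡ m) ∈ S) → IsGoodFlat (Edge G₂) (λ y → ι₂ y ∈ S) → e ≡ 2 * v ∸ 3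
    flat-over₁ all flat₂ with both-ends (all a₁) (all b₁)
    ... | ab≡1 , ca≡1 , cb≡1 = glued-count e v k r e+2 v+2
      where
      r : ℕ
      r = sum-inner (C.p₂ p) a₂ b₂
      v₂≡ : v₂ ≡ suc (suc r)
      v₂≡ = vertices-both-ends (C.p₂ p) a₂ b₂ a₂≢b₂ (trans (C.p₂-a p) ([]=⇒lookup (all a₁)))
                                                    (trans (C.p₂-b p) ([]=⇒lookup (all b₁)))
      e+2 : e + 2 ≡ 2 * suc k + (2 * suc (suc r) ∸ 3)
      e+2 = begin
        e + 2 * 1        ≡⟨ cong (λ z → e + 2 * z) (sym ab≡1) ⟩
        e + 2 * C.ab p   ≡⟨ C.edges-collision p ⟩
        e₁ + e₂          ≡⟨ cong₂ _+_ (edges-all spade₁ (λ x → []=⇒lookup (all x)))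
                                      (trans (edges-flat spade₂ (C.p₂ p) ∈⇔ flat₂) (cong (λ z → 2 * z ∸ 3) v₂≡)) ⟩
        2 * suc k + (2 * suc (suc r) ∸ 3) ∎
      v+2 : v + 2 ≡ suc (suc k) + suc (suc r)
      v+2 = begin
        v + 2                                   ≡⟨ sym (+-assoc v 1 1) ⟩
        v + 1 + 1                               ≡⟨ cong₂ (λ x y → v + x + y) (sym ca≡1) (sym cb≡1) ⟩
        v + count01 (C.pa p) + count01 (C.pb p) ≡⟨ C.vertices-collision p ⟩
        v₁ + v₂                                 ≡⟨ cong₂ _+_ (vertices-all (λ x → []=⇒lookup (all x))) v₂≡ ⟩
        suc (suc k) + suc (suc r)               ∎

    flat-over₂ : (∀ y → ι₂ y ∈ S) → IsGoodFlat (Edge G₁) (λ x → (x ↑ˡ m) ∈ S) → e ≡ 2 * v ∸ 3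
    flat-over₂ all flat₁ with both-ends (subst (_∈ S) ι₂-a (all a₂)) (subst (_∈ S) ι₂-b (all b₂))
    ... | ab≡1 , ca≡1 , cb≡1 = glued-count e v m r e+2 v+2
      where
      r : ℕ
      r = sum-inner (C.p₁ p) a₁ b₁
      a∈ : (a₁ ↑ˡ m) ∈ S
      a∈ = subst (_∈ S) ι₂-a (all a₂)
      b∈ : (b₁ ↑ˡ m) ∈ S
      b∈ = subst (_∈ S) ι₂-b (all b₂)
      v₁≡ : v₁ ≡ suc (suc r)
      v₁≡ = vertices-both-ends (C.p₁ p) a₁ b₁ a₁≢b₁ ([]=⇒lookup a∈) ([]=⇒lookup b∈)
      e+2 : e + 2 ≡ 2 * suc m + (2 * suc (suc r) ∸ 3)
      e+2 = begin
        e + 2 * 1        ≡⟨ cong (λ z → e + 2 * z) (sym ab≡1) ⟩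
        e + 2 * C.ab p   ≡⟨ C.edges-collision p ⟩
        e₁ + e₂          ≡⟨ +-comm e₁ e₂ ⟩
        e₂ + e₁          ≡⟨ cong₂ _+_ (edges-all spade₂ (λ y → []=⇒lookup (all y)))
                                      (trans (edges-flat spade₁ (C.p₁ p) ∈⇔ flat₁) (cong (λ z → 2 * z ∸ 3) v₁≡)) ⟩
        2 * suc m + (2 * suc (suc r) ∸ 3) ∎
      v+2 : v + 2 ≡ suc (suc m) + suc (suc r)
      v+2 = begin
        v + 2                                   ≡⟨ sym (+-assoc v 1 1) ⟩
        v + 1 + 1                               ≡⟨ cong₂ (λ x y → v + x + y) (sym ca≡1) (sym cb≡1) ⟩
        v + count01 (C.pa p) + count01 (C.pb p) ≡⟨ C.vertices-collision p ⟩
        v₁ + v₂                                 ≡⟨ +-comm v₁ v₂ ⟩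
        v₂ + v₁                                 ≡⟨ cong₂ _+_ (vertices-all (λ y → []=⇒lookup (all y))) v₁≡ ⟩
        suc (suc m) + suc (suc r)               ∎

    edgesIn-flat : edgesIn G S ≡ 2 * ∣ S ∣ ∸ 3
    edgesIn-flat = trans (edgesIn≡edges G S) (trans e≡ (cong (λ z → 2 * z ∸ 3) (sym (∣∣≡vertices S))))
      where
      e≡ : e ≡ 2 * v ∸ 3
      e≡ with classify (_∈ S) (_∈? S) (GoodFlat⇒IsGoodFlat G S flat)
      ... | inside₁ ¬ab in-ends flat₁ = flat-inside₁ ¬ab in-ends flat₁
      ... | inside₂ ¬ab in-ends flat₂ = flat-inside₂ ¬ab in-ends flat₂
      ... | over₁ all flat₂ = flat-over₁ all flat₂
      ... | over₂ all flat₁ = flat-over₂ all flat₁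

  spade : Spade2 G
  spade = simple , GluedTwoConnected.twoConnected (gluing j₁ j₂) (proj₁ (proj₂ spade₁)) (proj₁ (proj₂ spade₂)) ,
          numEdges-collision , GoodFlatCount.edgesIn-flat

-- On one or two vertices a simple graph has fewer than 2(|V| - 1) edges.
spade-size : ∀ {n} {H : Graph n} {a b} → Spade2 H → H a b ≡ true → Σ ℕ λ k → n ≡ 3 + k
spade-size {suc zero} {a = zero} {zero} (simple , _) ab with () ← simple-edge≢ simple ab refl
spade-size {suc (suc zero)} {H} (_ , _ , numEdges≡2 , _) _ with H zero (suc zero) | numEdges≡2
... | true | ()
... | false | ()
spade-size {suc (suc (suc k))} _ _ = k , refl

proposition5p2 : ∀ {n₁ n₂ : ℕ} (G₁ : Graph n₁) (G₂ : Graph n₂)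
                   (a₁ b₁ : Fin n₁) (a₂ b₂ : Fin n₂)
                   → Spade2 G₁ → Spade2 G₂
                   → G₁ a₁ b₁ ≡ true → G₂ a₂ b₂ ≡ true
                   → Spade2 (collision G₁ G₂ a₁ b₁ a₂ b₂)
proposition5p2 G₁ G₂ a₁ b₁ a₂ b₂ spade₁ spade₂ a₁b₁ a₂b₂
  with spade-size spade₁ a₁b₁ | spade-size spade₂ a₂b₂
... | _ , refl | _ , refl = CollisionSpade2.spade G₁ G₂ a₁ b₁ a₂ b₂ spade₁ spade₂ a₁b₁ a₂b₂ zero zero
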